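{- Let $s$ be a positive integer, let $H$ be a connected graph and let $P=xyz$ be a path of length two such that $V(H)\cap V(P)=\{x\}$. Let $HxP$ denote the graph with vertex set $V(H)\cup V(P)$ and edge set $E(H)\cup E(P)$. If $(HxP)^2$ has a $[2,2s]$-factor, then one of the following holds: (a) $H^2$ contains a spanning closed $s$-trail $T$ such that the degree of $x$ in $T$ is at most $2s-2$; or (b) $H^2$ contains a spanning $s$-trail between $x$ and some vertex $x'\in N_H(x)$.
   Context: All graphs are finite, simple and undirected. The square $G^2$ of a graph $G$ is the graph on $V(G)$ in which two distinct vertices are adjacent if and only if their distance in $G$ is at most two. A $[2,2s]$-factor of a graph is a connected spanning subgraph in which every vertex has even degree at most $2s$. A trail between $u_0$ and $u_r$ is a sequence $u_0e_1u_1\cdots e_ru_r$ of vertices and distinct edges with $e_i=u_{i-1}u_i$; it is closed if $u_0=u_r$ and spanning if it contains every vertex of the graph. An $s$-trail between $u_0$ and $u_r$ is a trail starting at $u_0$ and ending at $u_r$ in which every vertex is visited at most $s$ times (so a spanning closed $s$-trail corresponds to a $[2,2s]$-factor). The degree of a vertex $v$ in a trail is the number of edges of the trail incident with $v$. $N_H(x)$ is the set of neighbours of $x$ in $H$. -}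

module Defs where

open import Data.Nat using (ℕ; zero; suc; _+_; _*_; _∸_; _≤_)
open import Data.Fin using (Fin; zero; suc)
open import Data.Fin.Properties using (_≟_)
open import Data.Bool using (Bool; true; false; if_then_else_)
open import Data.List using (List; []; _∷_)
open import Data.List.Membership.Propositional using (_∈_)
open import Data.List.Relation.Unary.Linked using (Linked)
open import Data.List.Relation.Unary.AllPairs using (AllPairs)
open import Data.Product using (Σ; ∃; _×_; _,_)
open import Data.Sum using (_⊎_)
open import Data.Unit using (⊤)
open import Data.Empty using (⊥)
open import Relation.Nullary using (¬_; does)
open import Relation.Binary.PropositionalEquality using (_≡_; _≢_)

record Graph (n : ℕ) : Set₁ where
  field
    Adj    : Fin n → Fin n → Set
    sym    : ∀ {u v} → Adj u v → Adj v u
    irrefl : ∀ {v} → ¬ Adj v v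
open Graph public using (Adj)

square : ∀ {n} → Graph n → Graph n
square {n} G = record
  { Adj    = λ u v → u ≢ v × (Adj G u v ⊎ Σ (Fin n) λ w → Adj G u w × Adj G w v)
  ; sym    = symm
  ; irrefl = λ { (ne , _) → ne Relation.Binary.PropositionalEquality.refl }
  }
  where
  open import Data.Sum using (inj₁; inj₂)
  open import Relation.Binary.PropositionalEquality using (refl) renaming (sym to ≡sym)
  symm : ∀ {u v} → u ≢ v × (Adj G u v ⊎ Σ (Fin n) λ w → Adj G u w × Adj G w v)
       → v ≢ u × (Adj G v u ⊎ Σ (Fin n) λ w → Adj G v w × Adj G w u)
  symm (ne , inj₁ a) = (λ e → ne (≡sym e)) , inj₁ (Graph.sym G a)
  symm (ne , inj₂ (w , a , b)) = (λ e → ne (≡sym e)) , inj₂ (w , Graph.sym G b , Graph.sym G a)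

ends : ∀ {A : Set} → A → List A → A
ends a []       = a
ends a (v ∷ vs) = ends v vs

edges : ∀ {A : Set} → List A → List (A × A)
edges []           = []
edges (a ∷ [])     = []
edges (a ∷ b ∷ vs) = (a , b) ∷ edges (b ∷ vs)

SameEdge : ∀ {A : Set} → A × A → A × A → Set
SameEdge (a , b) (c , d) = (a ≡ c × b ≡ d) ⊎ (a ≡ d × b ≡ c)

IsWalk : ∀ {n} → Graph n → List (Fin n) → Set
IsWalk G vs = Linked (Adj G) vs

IsTrail : ∀ {n} → Graph n → List (Fin n) → Set
IsTrail G vs = IsWalk G vs × AllPairs (λ e f → ¬ SameEdge e f) (edges vs)

Connected : ∀ {n} → Graph n → Set
Connected {n} G = ∀ (u v : Fin n) → Σ (List (Fin n)) λ vs → IsWalk G (u ∷ vs) × ends u vs ≡ v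

occ : ∀ {n} → Fin n → List (Fin n) → ℕ
occ v []       = 0
occ v (w ∷ ws) = (if does (v ≟ w) then 1 else 0) + occ v ws

trailDeg : ∀ {n} → Fin n → List (Fin n) → ℕ
trailDeg x []           = 0
trailDeg x (a ∷ [])     = 0
trailDeg x (a ∷ b ∷ vs) =
  (if does (x ≟ a) then 1 else if does (x ≟ b) then 1 else 0) + trailDeg x (b ∷ vs)

IsSTrailBetween : ∀ {n} → Graph n → ℕ → Fin n → Fin n → List (Fin n) → Set
IsSTrailBetween {n} G s a b vs =
  IsTrail G (a ∷ vs) × ends a vs ≡ b × (∀ (v : Fin n) → occ v (a ∷ vs) ≤ s)

-- A closed s-trail with start/end vertex a: a closed trail (uᵣ = u₀ = a) in
-- which every vertex is visited at most s times, the repeated end u₀ = uᵣ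
-- counted once (i.e. occurrences counted among u₁,…,uᵣ).
IsClosedSTrail : ∀ {n} → Graph n → ℕ → Fin n → List (Fin n) → Set
IsClosedSTrail {n} G s a vs =
  IsTrail G (a ∷ vs) × ends a vs ≡ a × (∀ (v : Fin n) → occ v vs ≤ s)

Spanning : ∀ {n} → List (Fin n) → Set
Spanning {n} vs = ∀ (v : Fin n) → v ∈ vs

countTrue : ∀ {n} → (Fin n → Bool) → ℕ
countTrue {zero}  f = 0
countTrue {suc n} f = (if f zero then 1 else 0) + countTrue {n} (λ i → f (suc i))

record SpanningSubgraph {n} (G : Graph n) : Set where
  field
    E     : Fin n → Fin n → Bool
    E-sym : ∀ u v → E u v ≡ E v u
    E-sub : ∀ u v → E u v ≡ true → Adj G u v
open SpanningSubgraph public using (E)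

asGraph : ∀ {n} {G : Graph n} → SpanningSubgraph G → Graph n
asGraph {G = G} F = record
  { Adj    = λ u v → E F u v ≡ true
  ; sym    = λ {u} {v} e → Relation.Binary.PropositionalEquality.trans (SpanningSubgraph.E-sym F v u) e
  ; irrefl = λ e → Graph.irrefl G (SpanningSubgraph.E-sub F _ _ e)
  }

degSub : ∀ {n} {G : Graph n} → SpanningSubgraph G → Fin n → ℕ
degSub F v = countTrue (E F v)

Is22sFactor : ∀ {n} (G : Graph n) → ℕ → SpanningSubgraph G → Set
Is22sFactor {n} G s F =
  Connected (asGraph F) ×
  (∀ (v : Fin n) → (∃ λ k → degSub F v ≡ 2 * k) × degSub F v ≤ 2 * s)

Has22sFactor : ∀ {n} → Graph n → ℕ → Set
Has22sFactor G s = Σ (SpanningSubgraph G) (Is22sFactor G s)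

-- HxP: H with a pendant path x y z attached at x.
-- Vertex set Fin (2 + n): zero = y, suc zero = z, suc (suc v) = v ∈ V(H).

HxPAdj : ∀ {n} → Graph n → Fin n → Fin (suc (suc n)) → Fin (suc (suc n)) → Set
HxPAdj H x (suc (suc u)) (suc (suc v)) = Adj H u v
HxPAdj H x zero          (suc (suc v)) = v ≡ x
HxPAdj H x (suc (suc u)) zero          = u ≡ x
HxPAdj H x zero          (suc zero)    = ⊤
HxPAdj H x (suc zero)    zero          = ⊤
HxPAdj H x _             _             = ⊥

HxP : ∀ {n} → Graph n → Fin n → Graph (suc (suc n))
HxP H x = record { Adj = HxPAdj H x ; sym = λ {u} {v} → sy {u} {v} ; irrefl = λ {v} → ir {v} }
  where
  sy : ∀ {u v} → HxPAdj H x u v → HxPAdj H x v u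
  sy {suc (suc u)} {suc (suc v)} a = Graph.sym H a
  sy {zero} {suc (suc v)} a = a
  sy {suc (suc u)} {zero} a = a
  sy {zero} {suc zero} a = a
  sy {suc zero} {zero} a = a
  sy {zero} {zero} ()
  sy {suc zero} {suc zero} ()
  sy {suc zero} {suc (suc v)} ()
  sy {suc (suc u)} {suc zero} ()
  ir : ∀ {v} → ¬ HxPAdj H x v v
  ir {suc (suc v)} a = Graph.irrefl H a
  ir {zero} ()
  ir {suc zero} ()

-- Let F be the factor.  The vertex z has even degree and can only be adjacent to y and x in
-- (HxP)², so F contains the path y z x.  Restricted to H, F leaves a subgraph e of H² and the odd
-- set D of H-neighbours of y in F, with deg_F v = deg_e v + [v ∈ D] + [v = x].  Since D ⊆ N_H[x],
-- any two vertices u, v of D are adjacent in H², and the edges yu, yv can be traded for the edge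
-- uv (or, if uv is already in e, for its removal) without changing parities or exceeding 2s.
-- Connectivity survives if u's component misses x (by parity it then holds another vertex of D,
-- and v is taken outside it), or if every vertex of D reaches x (then among three vertices of D
-- there is a non-adjacent pair, or they form a triangle and one of its edges can go).
-- Once D = {d}, an Euler trail of e from x to d is (b) when d ≠ x, and when d = x it is a closed
-- trail in which x has degree deg_e x = deg_F x − 2 ≤ 2s − 2.

module Submission where

open import Defs
open import Data.Nat using (ℕ; zero; suc; _+_; _*_; _∸_; _≤_; _<_; z≤n; s≤s; parity)
open import Data.Nat.Properties hiding (_≟_)
open import Data.Fin using (Fin; zero; suc)
open import Data.Fin.Properties using (_≟_; any?; all?; ¬∀⟶∃¬)
open import Data.Bool using (Bool; true; false; not; _∧_; _∨_; if_then_else_)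
import Data.Bool.Properties as Boolₚ
open import Data.Parity.Base as ℙ using (Parity; 0ℙ; 1ℙ)
import Data.Parity.Properties as ℙₚ
open import Data.List using (List; []; _∷_; _++_; [_])
open import Data.List.Relation.Unary.All as All using (All; []; _∷_)
open import Data.List.Relation.Unary.Any as Any using (Any; here; there)
open import Data.List.Relation.Unary.AllPairs using (AllPairs; []; _∷_)
import Data.List.Relation.Unary.AllPairs.Properties as AllPairs
import Data.List.Relation.Unary.All.Properties as Allₚ
open import Data.List.Relation.Unary.Linked using (Linked; []; [-]; _∷_)
open import Data.List.Membership.Propositional using (_∈_)
open import Data.List.Membership.Propositional.Properties using (∈-∃++)
open import Data.Product using (Σ; ∃; _×_; _,_; proj₁; proj₂; uncurry)
open import Data.Sum using (_⊎_; inj₁; inj₂)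
open import Data.Empty using (⊥-elim)
open import Function using (_∘_; mk⇔)
open import Relation.Binary.Construct.Closure.ReflexiveTransitive as Star using (Star; ε; _◅_; _◅◅_)
open import Relation.Nullary using (¬_; yes; no; does)
open import Relation.Binary.PropositionalEquality
  using (_≡_; _≢_; refl; sym; trans; cong; cong₂; subst; _≗_; module ≡-Reasoning)
open import Algebra.Properties.CommutativeMonoid.Sum +-0-commutativeMonoid
  using (sum; sum-cong-≗; ∑-distrib-+)
open import Data.Nat.Solver using (module +-*-Solver)
open +-*-Solver using (solve; _:=_; _:+_; _:*_; con)

private variable n : ℕ

-- Counting over Fin n

𝟙 : Bool → ℕ
𝟙 b = if b then 1 else 0

𝟙≤1 : ∀ b → 𝟙 b ≤ 1
𝟙≤1 true  = s≤s z≤n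
𝟙≤1 false = z≤n

𝟙-mono : ∀ {a b} → (a ≡ true → b ≡ true) → 𝟙 a ≤ 𝟙 b
𝟙-mono {true}  a⇒b rewrite a⇒b refl = ≤-refl
𝟙-mono {false} _ = z≤n

∧-true-elim : ∀ {a b} → a ∧ b ≡ true → a ≡ true × b ≡ true
∧-true-elim {true} b≡true = refl , b≡true

∧-not-true-elim : ∀ {a b} → a ∧ not b ≡ true → a ≡ true × b ≡ false
∧-not-true-elim {true} {false} _ = refl , refl

true≢false : true ≢ false
true≢false ()

_==_ : Fin n → Fin n → Bool
a == b = does (a ≟ b)

==-refl : (a : Fin n) → a == a ≡ true
==-refl a with a ≟ a
... | yes _  = refl
... | no a≢a = ⊥-elim (a≢a refl)

≢⇒==false : {a b : Fin n} → a ≢ b → a == b ≡ false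
≢⇒==false {a = a} {b} a≢b with a ≟ b
... | yes a≡b = ⊥-elim (a≢b a≡b)
... | no _    = refl

==⇒≡ : {a b : Fin n} → a == b ≡ true → a ≡ b
==⇒≡ {a = a} {b} _ with a ≟ b
... | yes a≡b = a≡b

countTrue≡sum : (f : Fin n → Bool) → countTrue f ≡ sum (𝟙 ∘ f)
countTrue≡sum {zero}  f = refl
countTrue≡sum {suc n} f = cong (𝟙 (f zero) +_) (countTrue≡sum (f ∘ suc))

countTrue-cong : {f g : Fin n → Bool} → f ≗ g → countTrue f ≡ countTrue g
countTrue-cong {f = f} {g} f≗g =
  trans (countTrue≡sum f) (trans (sum-cong-≗ (cong 𝟙 ∘ f≗g)) (sym (countTrue≡sum g)))

countTrue-mono : {f g : Fin n → Bool} → (∀ i → f i ≡ true → g i ≡ true) → countTrue f ≤ countTrue g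
countTrue-mono {zero}  f⊆g = z≤n
countTrue-mono {suc n} f⊆g = +-mono-≤ (𝟙-mono (f⊆g zero)) (countTrue-mono (f⊆g ∘ suc))

countTrue≤n : (f : Fin n → Bool) → countTrue f ≤ n
countTrue≤n {zero}  f = z≤n
countTrue≤n {suc n} f = +-mono-≤ (𝟙≤1 (f zero)) (countTrue≤n (f ∘ suc))

countTrue-none : {f : Fin n → Bool} → (∀ i → f i ≡ false) → countTrue f ≡ 0
countTrue-none {zero}  none = refl
countTrue-none {suc n} {f} none rewrite none zero = countTrue-none (none ∘ suc)

countTrue-witness : (f : Fin n → Bool) → 0 < countTrue f → ∃ λ i → f i ≡ true
countTrue-witness {suc n} f pos with f zero in f0
... | true  = zero , f0
... | false = let i , fi = countTrue-witness (f ∘ suc) pos in suc i , fi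

countTrue-pos : (f : Fin n → Bool) (i : Fin n) → f i ≡ true → 0 < countTrue f
countTrue-pos f zero    fi rewrite fi = s≤s z≤n
countTrue-pos f (suc i) fi = ≤-trans (countTrue-pos (f ∘ suc) i fi) (m≤n+m _ (𝟙 (f zero)))

countTrue-split : (f c : Fin n → Bool) →
                  countTrue f ≡ countTrue (λ i → f i ∧ c i) + countTrue (λ i → f i ∧ not (c i))
countTrue-split {zero}  f c = refl
countTrue-split {suc n} f c rewrite countTrue-split (f ∘ suc) (c ∘ suc) = step (f zero) (c zero)
  where
  A B : ℕ
  A = countTrue (λ i → f (suc i) ∧ c (suc i))
  B = countTrue (λ i → f (suc i) ∧ not (c (suc i)))
  step : ∀ a b → 𝟙 a + (A + B) ≡ 𝟙 (a ∧ b) + A + (𝟙 (a ∧ not b) + B)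
  step false b     = refl
  step true  true  = refl
  step true  false = sym (+-suc A B)

countTrue-at : (f : Fin n → Bool) (a : Fin n) → countTrue (λ i → f i ∧ i == a) ≡ 𝟙 (f a)
countTrue-at f zero = begin
  𝟙 (f zero ∧ true) + countTrue (λ i → f (suc i) ∧ false)
    ≡⟨ cong₂ (λ b k → 𝟙 b + k) (Boolₚ.∧-identityʳ (f zero)) (countTrue-none (Boolₚ.∧-zeroʳ ∘ f ∘ suc)) ⟩
  𝟙 (f zero) + 0
    ≡⟨ +-identityʳ _ ⟩
  𝟙 (f zero) ∎
  where open ≡-Reasoning
countTrue-at f (suc a) =
  trans (cong (λ b → 𝟙 b + countTrue (λ i → f (suc i) ∧ i == a)) (Boolₚ.∧-zeroʳ (f zero)))
        (countTrue-at (f ∘ suc) a)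

countTrue-single : (a : Fin n) → countTrue (_== a) ≡ 1
countTrue-single = countTrue-at (λ _ → true)

erase : (Fin n → Bool) → Fin n → Fin n → Bool
erase f a i = f i ∧ not (i == a)

erase-keeps : (f : Fin n → Bool) {a t : Fin n} → f t ≡ true → t ≢ a → erase f a t ≡ true
erase-keeps f ft t≢a rewrite ft | ≢⇒==false t≢a = refl

erase-⊆ : (f : Fin n → Bool) (a t : Fin n) → erase f a t ≡ true → f t ≡ true
erase-⊆ f a t = proj₁ ∘ ∧-not-true-elim

erase-≢ : (f : Fin n → Bool) {a t : Fin n} → erase f a t ≡ true → t ≢ a
erase-≢ f {a} ft refl = true≢false (trans (sym ft) (trans (cong (λ b → f a ∧ not b) (==-refl a)) (Boolₚ.∧-zeroʳ (f a))))

𝟙-erase : (f : Fin n → Bool) {a : Fin n} → f a ≡ true → ∀ p → 𝟙 (f p) ≡ 𝟙 (erase f a p) + 𝟙 (p == a)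
𝟙-erase f {a} fa p with p ≟ a
... | yes refl rewrite fa = refl
... | no _     = trans (cong 𝟙 (sym (Boolₚ.∧-identityʳ (f p)))) (sym (+-identityʳ _))

𝟙-erase₂ : (f : Fin n → Bool) {u v : Fin n} → u ≢ v → f u ≡ true → f v ≡ true →
           ∀ p → 𝟙 (f p) ≡ 𝟙 (erase (erase f u) v p) + 𝟙 (p == u) + 𝟙 (p == v)
𝟙-erase₂ f {u} {v} u≢v fu fv p = begin
  𝟙 (f p)                                        ≡⟨ 𝟙-erase f fu p ⟩
  𝟙 (erase f u p) + 𝟙 (p == u)                   ≡⟨ cong (_+ 𝟙 (p == u)) (𝟙-erase (erase f u) fv′ p) ⟩
  𝟙 (f′ p) + 𝟙 (p == v) + 𝟙 (p == u)             ≡⟨ solve 3 (λ X B A → X :+ B :+ A := X :+ A :+ B) refl (𝟙 (f′ p)) _ _ ⟩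
  𝟙 (f′ p) + 𝟙 (p == u) + 𝟙 (p == v)             ∎
  where
  open ≡-Reasoning
  f′ : Fin _ → Bool
  f′ = erase (erase f u) v
  fv′ : erase f u v ≡ true
  fv′ = erase-keeps f fv (u≢v ∘ sym)

countTrue-remove : (f : Fin n → Bool) (a : Fin n) → countTrue f ≡ 𝟙 (f a) + countTrue (erase f a)
countTrue-remove f a = trans (countTrue-split f (_== a)) (cong (_+ countTrue (erase f a)) (countTrue-at f a))

countTrue-erase : (f : Fin n → Bool) {a : Fin n} → f a ≡ true → countTrue f ≡ suc (countTrue (erase f a))
countTrue-erase f {a} fa = trans (countTrue-remove f a) (cong (λ b → 𝟙 b + countTrue (erase f a)) fa)

countTrue-mono-< : {f g : Fin n → Bool} → (∀ i → f i ≡ true → g i ≡ true) →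
                   (a : Fin n) → f a ≡ false → g a ≡ true → countTrue f < countTrue g
countTrue-mono-< {f = f} {g} f⊆g a fa ga = begin-strict
  countTrue f                       ≡⟨ countTrue-remove f a ⟩
  𝟙 (f a) + countTrue (erase f a)   ≡⟨ cong (λ b → 𝟙 b + countTrue (erase f a)) fa ⟩
  countTrue (erase f a)             <⟨ s≤s (countTrue-mono restrict) ⟩
  1 + countTrue (erase g a)         ≡⟨ cong (λ b → 𝟙 b + countTrue (erase g a)) ga ⟨
  𝟙 (g a) + countTrue (erase g a)   ≡⟨ countTrue-remove g a ⟨
  countTrue g                       ∎
  where
  open ≤-Reasoning
  restrict : ∀ i → erase f a i ≡ true → erase g a i ≡ true
  restrict i fi′ with ∧-not-true-elim fi′
  ... | fi , i≠a rewrite f⊆g i fi | i≠a = refl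

countTrue≡1 : (f : Fin n → Bool) → countTrue f ≡ 1 → ∃ λ d → ∀ t → f t ≡ t == d
countTrue≡1 f one with countTrue-witness f (≤-reflexive (sym one))
... | d , fd = d , only-d
  where
  only-d : ∀ t → f t ≡ t == d
  only-d t with t ≟ d
  ... | yes refl = fd
  ... | no t≢d with f t in ft
  ... | false = refl
  ... | true  = ⊥-elim (<-irrefl (suc-injective (trans (sym one) (countTrue-erase f fd)))
                                 (countTrue-pos (erase f d) t (erase-keeps f ft t≢d)))

countTrue-three : (f : Fin n → Bool) → 3 ≤ countTrue f →
                  ∃ λ u → ∃ λ v → ∃ λ w → f u ≡ true × f v ≡ true × f w ≡ true × u ≢ v × w ≢ u × w ≢ v
countTrue-three f three =
  let u , fu      = countTrue-witness f (≤-trans (s≤s z≤n) three)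
      two         = ≤-pred (subst (3 ≤_) (countTrue-erase f fu) three)
      v , f∖u-v   = countTrue-witness (erase f u) (≤-trans (s≤s z≤n) two)
      one         = ≤-pred (subst (2 ≤_) (countTrue-erase (erase f u) f∖u-v) two)
      w , f∖u∖v-w = countTrue-witness (erase (erase f u) v) one
      f∖u-w       = erase-⊆ (erase f u) v w f∖u∖v-w
  in u , v , w , fu , erase-⊆ f u v f∖u-v , erase-⊆ f u w f∖u-w ,
     erase-≢ f f∖u-v ∘ sym , erase-≢ f f∖u-w , erase-≢ (erase f u) f∖u∖v-w

sum-mono : {f g : Fin n → ℕ} → (∀ i → f i ≤ g i) → sum f ≤ sum g
sum-mono {zero}  f≤g = z≤n
sum-mono {suc n} f≤g = +-mono-≤ (f≤g zero) (sum-mono (f≤g ∘ suc))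

sum-mono-< : {f g : Fin n → ℕ} → (∀ i → f i ≤ g i) → (a : Fin n) → f a < g a → sum f < sum g
sum-mono-< f≤g zero    fa<ga = +-mono-<-≤ fa<ga (sum-mono (f≤g ∘ suc))
sum-mono-< f≤g (suc a) fa<ga = +-mono-≤-< (f≤g zero) (sum-mono-< (f≤g ∘ suc) a fa<ga)

-- Parity and the handshake lemma

Even : ℕ → Set
Even m = parity m ≡ 0ℙ

parity-2* : ∀ k → parity (2 * k) ≡ 0ℙ
parity-2* k = ℙₚ.*-homo-* 2 k

parity-even+ : ∀ a b → Even a → parity (a + b) ≡ parity b
parity-even+ a b even-a = trans (ℙₚ.+-homo-+ a b) (cong (ℙ._+ parity b) even-a)

parity-2*+ : ∀ k m → parity (2 * k + m) ≡ parity m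
parity-2*+ k m = parity-even+ (2 * k) m (parity-2* k)

parity-+2* : ∀ m k → parity (m + 2 * k) ≡ parity m
parity-+2* m k = trans (cong parity (+-comm m (2 * k))) (parity-2*+ k m)

parity-+-twice : ∀ m k → parity (m + k + k) ≡ parity m
parity-+-twice m k = trans (cong parity (solve 2 (λ m k → m :+ k :+ k := m :+ con 2 :* k) refl m k)) (parity-+2* m k)

parity-suc-even : ∀ k → parity (suc k) ≡ 0ℙ → parity k ≡ 1ℙ
parity-suc-even k even = trans (sym (ℙₚ.suc-homo-⁻¹ k)) (cong ℙ._⁻¹ even)

odd⇒pos : ∀ {k} → parity k ≡ 1ℙ → 0 < k
odd⇒pos {suc k} _ = s≤s z≤n

sum-even : (f : Fin n → ℕ) → (∀ i → Even (f i)) → Even (sum f)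
sum-even {zero}  f even-f = refl
sum-even {suc n} f even-f = trans (parity-even+ (f zero) _ (even-f zero)) (sum-even (f ∘ suc) (even-f ∘ suc))

handshake : (g : Fin n → Fin n → Bool) → (∀ p q → g p q ≡ g q p) → (∀ p → g p p ≡ false) →
            Even (sum (λ p → countTrue (g p)))
handshake {zero}  g g-sym g-irr = refl
handshake {suc n} g g-sym g-irr = begin
  parity (countTrue (g zero) + sum (λ p → countTrue (g (suc p))))
    ≡⟨ cong (λ b → parity (𝟙 b + A + sum (λ p → countTrue (g (suc p))))) (g-irr zero) ⟩
  parity (A + sum (λ p → 𝟙 (g (suc p) zero) + countTrue (g′ p)))
    ≡⟨ cong (λ k → parity (A + k)) (∑-distrib-+ (λ p → 𝟙 (g (suc p) zero)) (countTrue ∘ g′)) ⟩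
  parity (A + (sum (λ p → 𝟙 (g (suc p) zero)) + sum (countTrue ∘ g′)))
    ≡⟨ cong (λ k → parity (A + (k + sum (countTrue ∘ g′)))) column≡row ⟩
  parity (A + (A + sum (countTrue ∘ g′)))
    ≡⟨ cong parity (solve 2 (λ A R → A :+ (A :+ R) := con 2 :* A :+ R) refl A (sum (countTrue ∘ g′))) ⟩
  parity (2 * A + sum (countTrue ∘ g′))
    ≡⟨ parity-2*+ A _ ⟩
  parity (sum (countTrue ∘ g′))
    ≡⟨ handshake g′ (λ p q → g-sym (suc p) (suc q)) (g-irr ∘ suc) ⟩
  0ℙ ∎
  where
  open ≡-Reasoning
  g′ : Fin n → Fin n → Bool
  g′ p q = g (suc p) (suc q)
  A : ℕ
  A = countTrue (λ q → g zero (suc q))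
  column≡row : sum (λ p → 𝟙 (g (suc p) zero)) ≡ A
  column≡row = trans (sym (countTrue≡sum (λ p → g (suc p) zero)))
                     (countTrue-cong (λ p → g-sym (suc p) zero))

-- Reachability

some : (Fin n → Bool) → Bool
some f = does (any? (λ i → f i Boolₚ.≟ true))

some-witness : (f : Fin n → Bool) → some f ≡ true → ∃ λ i → f i ≡ true
some-witness f _ with any? (λ i → f i Boolₚ.≟ true)
... | yes found = found

some-intro : (f : Fin n → Bool) (i : Fin n) → f i ≡ true → some f ≡ true
some-intro f i fi with any? (λ i → f i Boolₚ.≟ true)
... | yes _    = refl
... | no none = ⊥-elim (none (i , fi))

some-none : (f : Fin n → Bool) → some f ≡ false → ∀ i → f i ≡ false
some-none f none i with f i in fi
... | false = refl
... | true  = ⊥-elim (true≢false (trans (sym (some-intro f i fi)) none))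

Path : (Fin n → Fin n → Bool) → Fin n → Fin n → Set
Path r = Star (λ u v → r u v ≡ true)

Closed : (Fin n → Fin n → Bool) → (Fin n → Bool) → Set
Closed r S = ∀ p q → S p ≡ true → r p q ≡ true → S q ≡ true

module Reachability (r : Fin n → Fin n → Bool) where

  grow : (Fin n → Bool) → Fin n → Bool
  grow S q = S q ∨ some (λ p → S p ∧ r p q)

  grow-⊇ : ∀ S q → S q ≡ true → grow S q ≡ true
  grow-⊇ S q Sq rewrite Sq = refl

  grow-cases : ∀ S q → grow S q ≡ true → S q ≡ true ⊎ ∃ λ p → S p ≡ true × r p q ≡ true
  grow-cases S q _    with S q
  grow-cases S q _    | true = inj₁ refl
  grow-cases S q step | false = inj₂ (let p , hp = some-witness _ step in p , ∧-true-elim hp)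

  grow-closed : ∀ S → Closed r S → Closed r (grow S)
  grow-closed S closed p q Gp rpq with grow-cases S p Gp
  ... | inj₁ Sp = grow-⊇ S q (closed p q Sp rpq)
  ... | inj₂ (o , So , rop) = grow-⊇ S q (closed p q (closed o p So rop) rpq)

  closed-or-escape : ∀ S → Closed r S ⊎ ∃ λ q → S q ≡ false × grow S q ≡ true
  closed-or-escape S with all? (λ p → all? (λ q → (not (S p ∧ r p q) ∨ S q) Boolₚ.≟ true))
  ... | yes ok = inj₁ λ p q Sp rpq → reading (ok p q) Sp rpq
    where
    reading : ∀ {p q} → not (S p ∧ r p q) ∨ S q ≡ true → S p ≡ true → r p q ≡ true → S q ≡ true
    reading h Sp rpq rewrite Sp | rpq = h
  ... | no fails with ¬∀⟶∃¬ _ _ (λ p → all? (λ q → (not (S p ∧ r p q) ∨ S q) Boolₚ.≟ true)) fails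
  ... | p , fails-p with ¬∀⟶∃¬ _ _ (λ q → (not (S p ∧ r p q) ∨ S q) Boolₚ.≟ true) fails-p
  ... | q , fails-pq with S p in Sp | r p q in rpq | S q in Sq
  ... | true  | true  | false =
    inj₂ (q , Sq , trans (cong (_∨ some (λ o → S o ∧ r o q)) Sq) (some-intro _ p (cong₂ _∧_ Sp rpq)))
  ... | true  | true  | true  = ⊥-elim (fails-pq refl)
  ... | true  | false | _     = ⊥-elim (fails-pq refl)
  ... | false | _     | _     = ⊥-elim (fails-pq refl)

  iterate : ℕ → (Fin n → Bool) → Fin n → Bool
  iterate zero    S = S
  iterate (suc k) S = grow (iterate k S)

  iterate-⊇ : ∀ k S q → S q ≡ true → iterate k S q ≡ true
  iterate-⊇ zero    S q Sq = Sq
  iterate-⊇ (suc k) S q Sq = grow-⊇ _ q (iterate-⊇ k S q Sq)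

  iterate-reachable : ∀ k S q → iterate k S q ≡ true → ∃ λ p → S p ≡ true × Path r p q
  iterate-reachable zero    S q Sq = q , Sq , ε
  iterate-reachable (suc k) S q Iq with grow-cases (iterate k S) q Iq
  ... | inj₁ Iq′ = iterate-reachable k S q Iq′
  ... | inj₂ (p , Ip , rpq) =
    let o , So , o⇝p = iterate-reachable k S p Ip in o , So , o⇝p ◅◅ (rpq ◅ ε)

  -- Each round either has closed the set or added a vertex, so n rounds suffice.
  iterate-closed-or-large : ∀ S → 1 ≤ countTrue S → ∀ k → Closed r (iterate k S) ⊎ k < countTrue (iterate k S)
  iterate-closed-or-large S nonempty zero = inj₂ nonempty
  iterate-closed-or-large S nonempty (suc k) with iterate-closed-or-large S nonempty k
  ... | inj₁ closed = inj₁ (grow-closed _ closed)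
  ... | inj₂ large with closed-or-escape (iterate k S)
  ... | inj₁ closed = inj₁ (grow-closed _ closed)
  ... | inj₂ (q , out , in′) = inj₂ (≤-trans (s≤s large) (countTrue-mono-< (grow-⊇ _) q out in′))

  component : Fin n → Fin n → Bool
  component u = iterate n (_== u)

  component-self : ∀ u → component u u ≡ true
  component-self u = iterate-⊇ n _ u (==-refl u)

  component-closed : ∀ u → Closed r (component u)
  component-closed u with iterate-closed-or-large (_== u) (≤-reflexive (sym (countTrue-single u))) n
  ... | inj₁ closed = closed
  ... | inj₂ large  = ⊥-elim (<⇒≱ large (countTrue≤n _))

  component-reachable : ∀ u q → component u q ≡ true → Path r u q
  component-reachable u q uq with iterate-reachable n (_== u) q uq
  ... | p , p≡u , p⇝q = subst (λ o → Path r o q) (==⇒≡ p≡u) p⇝q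

-- Graphs as Boolean adjacency relations

record BoolGraph (n : ℕ) : Set where
  field
    adj        : Fin n → Fin n → Bool
    adj-sym    : ∀ u v → adj u v ≡ adj v u
    adj-irrefl : ∀ v → adj v v ≡ false
open BoolGraph public

Edge : BoolGraph n → Fin n × Fin n → Set
Edge g (p , q) = adj g p q ≡ true

deg : BoolGraph n → Fin n → ℕ
deg g v = countTrue (adj g v)

degSum : BoolGraph n → ℕ
degSum g = sum (deg g)

adj⇒≢ : (g : BoolGraph n) {p q : Fin n} → adj g p q ≡ true → p ≢ q
adj⇒≢ g {p} pq refl = true≢false (trans (sym pq) (adj-irrefl g p))

-- Handshake lemma for the edges inside C: as C is closed, its degree sum counts each edge twice.
closed-weight-even : (g : BoolGraph n) (C : Fin n → Bool) → Closed (adj g) C → (w : Fin n → ℕ) →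
                     (∀ v → Even (deg g v + w v)) → Even (sum (λ v → if C v then w v else 0))
closed-weight-even g C closed w even =
  trans (sym (parity-even+ (sum (countTrue ∘ gC)) _ (handshake gC gC-sym gC-irrefl)))
        (trans (cong parity (sym (trans (sum-cong-≗ split) (∑-distrib-+ (countTrue ∘ gC) _))))
               (sum-even _ total-even))
  where
  gC : Fin _ → Fin _ → Bool
  gC p q = C p ∧ adj g p q
  gC-sym : ∀ p q → gC p q ≡ gC q p
  gC-sym p q = Boolₚ.⇔→≡ {z = true} (mk⇔ (flip p q) (flip q p))
    where
    flip : ∀ p q → gC p q ≡ true → gC q p ≡ true
    flip p q Cp∧pq with ∧-true-elim Cp∧pq
    ... | Cp , pq = cong₂ _∧_ (closed p q Cp pq) (trans (adj-sym g q p) pq)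
  gC-irrefl : ∀ p → gC p p ≡ false
  gC-irrefl p = trans (cong (C p ∧_) (adj-irrefl g p)) (Boolₚ.∧-zeroʳ (C p))
  split : ∀ v → (if C v then deg g v + w v else 0) ≡ countTrue (gC v) + (if C v then w v else 0)
  split v with C v
  ... | true  = refl
  ... | false = sym (trans (+-identityʳ _) (countTrue-none {f = λ q → false ∧ adj g v q} (λ _ → refl)))
  total-even : ∀ v → Even (if C v then deg g v + w v else 0)
  total-even v with C v
  ... | true  = even v
  ... | false = refl

sameEdge : (e f : Fin n × Fin n) → Bool
sameEdge (a , b) (c , d) = (a == c ∧ b == d) ∨ (a == d ∧ b == c)

sameEdge-sound : (e f : Fin n × Fin n) → sameEdge e f ≡ true → SameEdge e f
sameEdge-sound (a , b) (c , d) same with a == c in ac | b == d in bd | a == d in ad | b == c in bc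
... | true  | true  | _     | _     = inj₁ (==⇒≡ ac , ==⇒≡ bd)
... | true  | false | true  | true  = inj₂ (==⇒≡ ad , ==⇒≡ bc)
... | false | _     | true  | true  = inj₂ (==⇒≡ ad , ==⇒≡ bc)

sameEdge-complete : (e f : Fin n × Fin n) → SameEdge e f → sameEdge e f ≡ true
sameEdge-complete (a , b) (.a , .b) (inj₁ (refl , refl)) rewrite ==-refl a | ==-refl b = refl
sameEdge-complete (a , b) (.b , .a) (inj₂ (refl , refl)) rewrite ==-refl a | ==-refl b =
  Boolₚ.∨-zeroʳ (a == b ∧ b == a)

sameEdge-flip : (p q : Fin n) (f : Fin n × Fin n) → sameEdge (p , q) f ≡ sameEdge (q , p) f
sameEdge-flip p q (c , d) =
  trans (Boolₚ.∨-comm (p == c ∧ q == d) _) (cong₂ _∨_ (Boolₚ.∧-comm (p == d) _) (Boolₚ.∧-comm (p == c) _))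

SameEdge-sym : {e f : Fin n × Fin n} → SameEdge e f → SameEdge f e
SameEdge-sym (inj₁ (refl , refl)) = inj₁ (refl , refl)
SameEdge-sym (inj₂ (refl , refl)) = inj₂ (refl , refl)

mentions : Fin n × Fin n → List (Fin n × Fin n) → Bool
mentions e []       = false
mentions e (f ∷ fs) = sameEdge e f ∨ mentions e fs

mentions-sound : (e : Fin n × Fin n) (fs : List (Fin n × Fin n)) → mentions e fs ≡ true → Any (SameEdge e) fs
mentions-sound e (f ∷ fs) m with sameEdge e f in ef
... | true  = here (sameEdge-sound e f ef)
... | false = there (mentions-sound e fs m)

mentions-complete : (e : Fin n × Fin n) {fs : List (Fin n × Fin n)} → Any (SameEdge e) fs → mentions e fs ≡ true
mentions-complete e {f ∷ _}  (here same) rewrite sameEdge-complete e f same = refl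
mentions-complete e {f ∷ fs} (there any) rewrite mentions-complete e any = Boolₚ.∨-zeroʳ (sameEdge e f)

mentions-flip : (p q : Fin n) (fs : List (Fin n × Fin n)) → mentions (p , q) fs ≡ mentions (q , p) fs
mentions-flip p q []       = refl
mentions-flip p q (f ∷ fs) = cong₂ _∨_ (sameEdge-flip p q f) (mentions-flip p q fs)

mentions-++ : (e : Fin n × Fin n) (fs gs : List (Fin n × Fin n)) →
              mentions e (fs ++ gs) ≡ mentions e fs ∨ mentions e gs
mentions-++ e []       gs = refl
mentions-++ e (f ∷ fs) gs = trans (cong (sameEdge e f ∨_) (mentions-++ e fs gs)) (sym (Boolₚ.∨-assoc (sameEdge e f) _ _))

infixl 6 _∖_
_∖_ : BoolGraph n → List (Fin n × Fin n) → BoolGraph n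
g ∖ fs = record
  { adj        = λ p q → adj g p q ∧ not (mentions (p , q) fs)
  ; adj-sym    = λ p q → cong₂ (λ a m → a ∧ not m) (adj-sym g p q) (mentions-flip p q fs)
  ; adj-irrefl = λ p → cong (_∧ _) (adj-irrefl g p)
  }

∖-⊆ : (g : BoolGraph n) (fs : List (Fin n × Fin n)) {p q : Fin n} → adj (g ∖ fs) p q ≡ true → adj g p q ≡ true
∖-⊆ g fs = proj₁ ∘ ∧-true-elim

∖-[] : (g : BoolGraph n) (p q : Fin n) → adj (g ∖ []) p q ≡ adj g p q
∖-[] g p q = Boolₚ.∧-identityʳ (adj g p q)

∖-∷ : (g : BoolGraph n) (f : Fin n × Fin n) (fs : List (Fin n × Fin n)) (p q : Fin n) →
      adj (g ∖ [ f ] ∖ fs) p q ≡ adj (g ∖ (f ∷ fs)) p q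
∖-∷ g f fs p q with adj g p q | sameEdge (p , q) f
... | false | _     = refl
... | true  | true  = refl
... | true  | false = refl

∖-keep : (g : BoolGraph n) {f : Fin n × Fin n} {p q : Fin n} →
         adj g p q ≡ true → ¬ SameEdge f (p , q) → adj (g ∖ [ f ]) p q ≡ true
∖-keep g {f} {p} {q} pq f≉pq with sameEdge (p , q) f in same
... | true  = ⊥-elim (f≉pq (SameEdge-sym (sameEdge-sound (p , q) f same)))
... | false rewrite pq = refl

deleted-apart : (g : BoolGraph n) (fs : List (Fin n × Fin n)) {e : Fin n × Fin n} →
                Edge (g ∖ fs) e → All (λ f → ¬ SameEdge f e) fs
deleted-apart g fs {p , q} kept = All.tabulate λ f∈fs same →
  true≢false (trans (sym (mentions-complete (p , q) (Any.map (λ { refl → SameEdge-sym same }) f∈fs)))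
                    (proj₂ (∧-not-true-elim kept)))

∖-removed : (g : BoolGraph n) (fs : List (Fin n × Fin n)) {p q : Fin n} →
            adj g p q ≡ true → adj (g ∖ fs) p q ≡ false → Any (SameEdge (p , q)) fs
∖-removed g fs {p} {q} pq gone rewrite pq with mentions (p , q) fs in m
... | true = mentions-sound (p , q) fs m

deg-∖-≤ : (g : BoolGraph n) (fs : List (Fin n × Fin n)) (v : Fin n) → deg (g ∖ fs) v ≤ deg g v
deg-∖-≤ g fs v = countTrue-mono (λ q → ∖-⊆ g fs {v} {q})

incident-count : (g : BoolGraph n) {c d : Fin n} → adj g c d ≡ true → ∀ v →
                 countTrue (λ q → adj g v q ∧ sameEdge (v , q) (c , d)) ≡ 𝟙 (v == c) + 𝟙 (v == d)
incident-count g {c} {d} cd v with v ≟ c | v ≟ d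
... | yes refl | yes refl = ⊥-elim (adj⇒≢ g cd refl)
... | yes refl | no _ = begin
  countTrue (λ q → adj g c q ∧ (q == d ∨ false))
    ≡⟨ countTrue-cong (λ q → cong (adj g c q ∧_) (Boolₚ.∨-identityʳ (q == d))) ⟩
  countTrue (λ q → adj g c q ∧ q == d) ≡⟨ countTrue-at (adj g c) d ⟩
  𝟙 (adj g c d)                        ≡⟨ cong 𝟙 cd ⟩
  1                                    ∎
  where open ≡-Reasoning
... | no _ | yes refl = trans (countTrue-at (adj g d) c) (cong 𝟙 (trans (adj-sym g d c) cd))
... | no _ | no _ = countTrue-none (λ q → Boolₚ.∧-zeroʳ (adj g v q))

deg-∖-edge : (g : BoolGraph n) {c d : Fin n} → adj g c d ≡ true → ∀ v →
             deg g v ≡ deg (g ∖ [ (c , d) ]) v + 𝟙 (v == c) + 𝟙 (v == d)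
deg-∖-edge g {c} {d} cd v = begin
  deg g v
    ≡⟨ countTrue-split (adj g v) (λ q → sameEdge (v , q) (c , d)) ⟩
  countTrue (λ q → adj g v q ∧ sameEdge (v , q) (c , d)) + countTrue (λ q → adj g v q ∧ not (sameEdge (v , q) (c , d)))
    ≡⟨ cong₂ _+_ (incident-count g cd v)
                 (countTrue-cong λ q → cong (λ m → adj g v q ∧ not m) (sym (Boolₚ.∨-identityʳ _))) ⟩
  𝟙 (v == c) + 𝟙 (v == d) + deg (g ∖ [ (c , d) ]) v
    ≡⟨ +-comm (𝟙 (v == c) + 𝟙 (v == d)) _ ⟩
  deg (g ∖ [ (c , d) ]) v + (𝟙 (v == c) + 𝟙 (v == d))
    ≡⟨ +-assoc (deg (g ∖ [ (c , d) ]) v) _ _ ⟨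
  deg (g ∖ [ (c , d) ]) v + 𝟙 (v == c) + 𝟙 (v == d) ∎
  where open ≡-Reasoning

addEdge : (g : BoolGraph n) (u v : Fin n) → u ≢ v → BoolGraph n
addEdge g u v u≢v = record
  { adj        = λ p q → adj g p q ∨ sameEdge (p , q) (u , v)
  ; adj-sym    = λ p q → cong₂ _∨_ (adj-sym g p q) (sameEdge-flip p q (u , v))
  ; adj-irrefl = irrefl
  }
  where
  irrefl : ∀ p → adj g p p ∨ sameEdge (p , p) (u , v) ≡ false
  irrefl p rewrite adj-irrefl g p with sameEdge (p , p) (u , v) in same
  ... | false = refl
  ... | true with sameEdge-sound (p , p) (u , v) same
  ... | inj₁ (refl , refl) = ⊥-elim (u≢v refl)
  ... | inj₂ (refl , refl) = ⊥-elim (u≢v refl)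

module _ (g : BoolGraph n) {u v : Fin n} (u≢v : u ≢ v) where

  addEdge-new : adj (addEdge g u v u≢v) u v ≡ true
  addEdge-new rewrite ==-refl u | ==-refl v = Boolₚ.∨-zeroʳ (adj g u v)

  addEdge-⊇ : ∀ {p q} → adj g p q ≡ true → adj (addEdge g u v u≢v) p q ≡ true
  addEdge-⊇ pq rewrite pq = refl

  addEdge-cases : ∀ {p q} → adj (addEdge g u v u≢v) p q ≡ true → adj g p q ≡ true ⊎ SameEdge (p , q) (u , v)
  addEdge-cases {p} {q} added with adj g p q
  ... | true  = inj₁ refl
  ... | false = inj₂ (sameEdge-sound (p , q) (u , v) added)

  deg-addEdge : adj g u v ≡ false → ∀ p → deg (addEdge g u v u≢v) p ≡ deg g p + 𝟙 (p == u) + 𝟙 (p == v)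
  deg-addEdge absent p =
    trans (deg-∖-edge (addEdge g u v u≢v) addEdge-new p)
          (cong (λ k → k + 𝟙 (p == u) + 𝟙 (p == v)) (countTrue-cong (removed-again p)))
    where
    removed-again : ∀ p q → adj (addEdge g u v u≢v ∖ [ (u , v) ]) p q ≡ adj g p q
    removed-again p q with sameEdge (p , q) (u , v) in same
    ... | false = trans (Boolₚ.∧-identityʳ _) (Boolₚ.∨-identityʳ _)
    ... | true with sameEdge-sound (p , q) (u , v) same
    ... | inj₁ (refl , refl) = trans (Boolₚ.∧-zeroʳ _) (sym absent)
    ... | inj₂ (refl , refl) = trans (Boolₚ.∧-zeroʳ _) (sym (trans (adj-sym g _ _) absent))

Distinct : List (Fin n × Fin n) → Set
Distinct = AllPairs (λ e f → ¬ SameEdge e f)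

incidence : Fin n → List (Fin n × Fin n) → ℕ
incidence v []             = 0
incidence v ((p , q) ∷ es) = 𝟙 (v == p) + 𝟙 (v == q) + incidence v es

deg-∖ : (g : BoolGraph n) (es : List (Fin n × Fin n)) → All (Edge g) es → Distinct es →
        ∀ v → deg g v ≡ deg (g ∖ es) v + incidence v es
deg-∖ g []             []          []              v = trans (countTrue-cong (sym ∘ ∖-[] g v)) (sym (+-identityʳ _))
deg-∖ g ((c , d) ∷ fs) (cd ∷ in-g) (apart ∷ distinct) v = begin
  deg g v                                                    ≡⟨ deg-∖-edge g cd v ⟩
  deg g′ v + 𝟙 (v == c) + 𝟙 (v == d)                         ≡⟨ cong (λ k → k + 𝟙 (v == c) + 𝟙 (v == d)) ih ⟩
  deg (g′ ∖ fs) v + incidence v fs + 𝟙 (v == c) + 𝟙 (v == d)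
    ≡⟨ cong (λ k → k + incidence v fs + 𝟙 (v == c) + 𝟙 (v == d)) (countTrue-cong (∖-∷ g (c , d) fs v)) ⟩
  deg (g ∖ ((c , d) ∷ fs)) v + incidence v fs + 𝟙 (v == c) + 𝟙 (v == d)
    ≡⟨ solve 4 (λ X I A B → X :+ I :+ A :+ B := X :+ (A :+ B :+ I)) refl (deg (g ∖ ((c , d) ∷ fs)) v) _ _ _ ⟩
  deg (g ∖ ((c , d) ∷ fs)) v + incidence v ((c , d) ∷ fs)    ∎
  where
  open ≡-Reasoning
  g′ : BoolGraph _
  g′ = g ∖ [ (c , d) ]
  ih : deg g′ v ≡ deg (g′ ∖ fs) v + incidence v fs
  ih = deg-∖ g′ fs (All.zipWith (uncurry (∖-keep g)) (in-g , apart)) distinct v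

-- Trails and Euler trails

module _ {A : Set} where

  edges-++-∷ : (L : List A) (w : A) (M : List A) → edges (L ++ w ∷ M) ≡ edges (L ++ [ w ]) ++ edges (w ∷ M)
  edges-++-∷ []           w M = refl
  edges-++-∷ (x ∷ [])     w M = refl
  edges-++-∷ (x ∷ y ∷ L)  w M = cong ((x , y) ∷_) (edges-++-∷ (y ∷ L) w M)

  edges-∷-++ : (x : A) (cs M : List A) → edges (x ∷ cs ++ M) ≡ edges (x ∷ cs) ++ edges (ends x cs ∷ M)
  edges-∷-++ x []       M = refl
  edges-∷-++ x (y ∷ cs) M = cong ((x , y) ∷_) (edges-∷-++ y cs M)

  ends-++ : (a : A) (xs ys : List A) → ends a (xs ++ ys) ≡ ends (ends a xs) ys
  ends-++ a []       ys = refl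
  ends-++ a (x ∷ xs) ys = ends-++ x xs ys

  ends-∷≡++∷ : (a : A) (vs L : List A) (w : A) (M : List A) → a ∷ vs ≡ L ++ w ∷ M → ends a vs ≡ ends w M
  ends-∷≡++∷ a vs []      w M refl = refl
  ends-∷≡++∷ a _  (.a ∷ L) w M refl = ends-++ a L (w ∷ M)

  replace-suffix : (a : A) (vs L : List A) (w : A) (M M′ : List A) → a ∷ vs ≡ L ++ w ∷ M →
                   ∃ λ vs′ → a ∷ vs′ ≡ L ++ w ∷ M′
  replace-suffix a vs []      w M M′ refl = M′ , refl
  replace-suffix a vs (x ∷ L) w M M′ refl = L ++ w ∷ M′ , refl

  SameEdge-edges⇒∈ : {p q : A} (L : List A) → Any (SameEdge (p , q)) (edges L) → q ∈ L
  SameEdge-edges⇒∈ (a ∷ b ∷ L) (here (inj₁ (refl , refl))) = there (here refl)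
  SameEdge-edges⇒∈ (a ∷ b ∷ L) (here (inj₂ (refl , refl))) = here refl
  SameEdge-edges⇒∈ (a ∷ b ∷ L) (there same)               = there (SameEdge-edges⇒∈ (b ∷ L) same)

  AllPairs-++⁻ : {R : A → A → Set} (xs : List A) {ys : List A} → AllPairs R (xs ++ ys) →
                 AllPairs R xs × AllPairs R ys × All (λ x → All (R x) ys) xs
  AllPairs-++⁻ []       rs        = [] , rs , []
  AllPairs-++⁻ (x ∷ xs) (r ∷ rs) with AllPairs-++⁻ xs rs
  ... | rxs , rys , rxsys = Allₚ.++⁻ˡ xs r ∷ rxs , rys , Allₚ.++⁻ʳ xs r ∷ rxsys

IsTrailIn : BoolGraph n → List (Fin n) → Set
IsTrailIn g L = All (Edge g) (edges L) × Distinct (edges L)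

incidence+ends≡2*occ : (v a : Fin n) (vs : List (Fin n)) →
                       incidence v (edges (a ∷ vs)) + 𝟙 (v == a) + 𝟙 (v == ends a vs) ≡ 2 * occ v (a ∷ vs)
incidence+ends≡2*occ v a []       = solve 1 (λ A → con 0 :+ A :+ A := con 2 :* (A :+ con 0)) refl (𝟙 (v == a))
incidence+ends≡2*occ v a (b ∷ vs) = begin
  𝟙 (v == a) + 𝟙 (v == b) + I + 𝟙 (v == a) + End
    ≡⟨ solve 4 (λ A B I E → A :+ B :+ I :+ A :+ E := con 2 :* A :+ (I :+ B :+ E)) refl (𝟙 (v == a)) (𝟙 (v == b)) I End ⟩
  2 * 𝟙 (v == a) + (I + 𝟙 (v == b) + End)        ≡⟨ cong (2 * 𝟙 (v == a) +_) (incidence+ends≡2*occ v b vs) ⟩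
  2 * 𝟙 (v == a) + 2 * occ v (b ∷ vs)            ≡⟨ *-distribˡ-+ 2 (𝟙 (v == a)) _ ⟨
  2 * occ v (a ∷ b ∷ vs)                          ∎
  where
  open ≡-Reasoning
  I End : ℕ
  I = incidence v (edges (b ∷ vs))
  End = 𝟙 (v == ends b vs)

trailDeg≡incidence : (x : Fin n) (L : List (Fin n)) → All (λ e → proj₁ e ≢ proj₂ e) (edges L) →
                     trailDeg x L ≡ incidence x (edges L)
trailDeg≡incidence x []           _ = refl
trailDeg≡incidence x (a ∷ [])     _ = refl
trailDeg≡incidence x (a ∷ b ∷ vs) (a≢b ∷ loopless) =
  cong₂ _+_ first-edge (trailDeg≡incidence x (b ∷ vs) loopless)
  where
  first-edge : (if x == a then 1 else if x == b then 1 else 0) ≡ 𝟙 (x == a) + 𝟙 (x == b)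
  first-edge with x ≟ a
  ... | yes refl rewrite ≢⇒==false a≢b = refl
  ... | no _     = refl

∖-splice : (g : BoolGraph n) (xs ys zs : List (Fin n × Fin n)) (p q : Fin n) →
           adj (g ∖ (xs ++ ys ++ zs)) p q ≡ adj (g ∖ (xs ++ zs) ∖ ys) p q
∖-splice g xs ys zs p q
  rewrite mentions-++ (p , q) xs (ys ++ zs) | mentions-++ (p , q) ys zs | mentions-++ (p , q) xs zs
  with adj g p q | mentions (p , q) xs | mentions (p , q) ys | mentions (p , q) zs
... | false | _     | _     | _     = refl
... | true  | true  | _     | _     = refl
... | true  | false | true  | m     = sym (Boolₚ.∧-zeroʳ (not m))
... | true  | false | false | m     = sym (Boolₚ.∧-identityʳ (not m))

splice-trail : (g : BoolGraph n) (L : List (Fin n)) (w : Fin n) (M cs : List (Fin n)) →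
               IsTrailIn g (L ++ w ∷ M) → IsTrailIn (g ∖ edges (L ++ w ∷ M)) (w ∷ cs) → ends w cs ≡ w →
               IsTrailIn g (L ++ w ∷ cs ++ M)
splice-trail g L w M cs (in-g , distinct) (in-rest , distinct-C) closed
  rewrite edges-++-∷ L w (cs ++ M) | edges-∷-++ w cs M | closed | edges-++-∷ L w M =
  Allₚ.++⁺ in-L (Allₚ.++⁺ (All.map (∖-⊆ g (E₁ ++ E₃)) in-rest) in-M) ,
  AllPairs.++⁺ distinct-L (AllPairs.++⁺ distinct-C distinct-M C-M) (All.zipWith (uncurry Allₚ.++⁺) (L-C , L-M))
  where
  E₁ E₂ E₃ : List (Fin _ × Fin _)
  E₁ = edges (L ++ [ w ])
  E₂ = edges (w ∷ cs)
  E₃ = edges (w ∷ M)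
  in-L  = Allₚ.++⁻ˡ E₁ in-g
  in-M  = Allₚ.++⁻ʳ E₁ in-g
  split = AllPairs-++⁻ E₁ distinct
  distinct-L = proj₁ split
  distinct-M = proj₁ (proj₂ split)
  L-M        = proj₂ (proj₂ split)
  C-apart : All (λ e → All (λ f → ¬ SameEdge f e) (E₁ ++ E₃)) E₂
  C-apart = All.map (deleted-apart g (E₁ ++ E₃)) in-rest
  L-C : All (λ x → All (λ y → ¬ SameEdge x y) E₂) E₁
  L-C = All.tabulate λ x∈E₁ → All.tabulate λ y∈E₂ → All.lookup (Allₚ.++⁻ˡ E₁ (All.lookup C-apart y∈E₂)) x∈E₁
  C-M : All (λ y → All (λ z → ¬ SameEdge y z) E₃) E₂
  C-M = All.tabulate λ y∈E₂ → All.tabulate λ z∈E₃ same →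
          All.lookup (Allₚ.++⁻ʳ E₁ (All.lookup C-apart y∈E₂)) z∈E₃ (SameEdge-sym same)

occ-pos⇒∈ : (v : Fin n) (L : List (Fin n)) → 0 < occ v L → v ∈ L
occ-pos⇒∈ v (w ∷ L) pos with v ≟ w
... | yes refl = here refl
... | no _     = there (occ-pos⇒∈ v L pos)

trail⇒IsTrail : (g : BoolGraph n) (G : Graph n) → (∀ {u v} → adj g u v ≡ true → Adj G u v) →
                (L : List (Fin n)) → IsTrailIn g L → IsTrail G L
trail⇒IsTrail g G g⊆G L (in-g , distinct) = linked L in-g , distinct
  where
  linked : ∀ L → All (Edge g) (edges L) → Linked (Adj G) L
  linked []          _          = []
  linked (a ∷ [])    _          = [-]
  linked (a ∷ b ∷ L) (ab ∷ rest) = g⊆G ab ∷ linked (b ∷ L) rest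

EulerParity : BoolGraph n → Fin n → Fin n → Set
EulerParity g a b = ∀ v → Even (deg g v + 𝟙 (v == a) + 𝟙 (v == b))

record StuckTrail (g : BoolGraph n) (c b : Fin n) : Set where
  field
    vs    : List (Fin n)
    trail : IsTrailIn g (c ∷ vs)
    ends≡ : ends c vs ≡ b
    stuck : deg (g ∖ edges (c ∷ vs)) b ≡ 0

-- Walk along unused edges as long as possible: by parity the walk can only get stuck at b.
stuckTrail : (g : BoolGraph n) (c b : Fin n) → EulerParity g c b → StuckTrail g c b
stuckTrail g c b = go (suc (degSum g)) g c ≤-refl
  where
  go : ∀ k (g : BoolGraph _) c → degSum g < k → EulerParity g c b → StuckTrail g c b
  go (suc k) g c small even with some (adj g c) in has-edge
  ... | false = record { vs = [] ; trail = [] , [] ; ends≡ = c≡b ; stuck = stuck }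
    where
    isolated : deg g c ≡ 0
    isolated = countTrue-none (some-none (adj g c) has-edge)
    c≡b : c ≡ b
    c≡b with c ≟ b | even c
    ... | yes c≡b | _ = c≡b
    ... | no _ | odd rewrite isolated | ==-refl c with odd
    ... | ()
    stuck : deg (g ∖ []) b ≡ 0
    stuck = trans (countTrue-cong (∖-[] g b)) (subst (λ v → deg g v ≡ 0) c≡b isolated)
  ... | true with some-witness (adj g c) has-edge
  ... | d , cd = record
    { vs    = d ∷ R.vs
    ; trail = cd ∷ All.map (∖-⊆ g [ (c , d) ]) (proj₁ R.trail)
            , All.map (λ kept → All.head (deleted-apart g [ (c , d) ] kept)) (proj₁ R.trail) ∷ proj₂ R.trail
    ; ends≡ = R.ends≡
    ; stuck = trans (countTrue-cong (sym ∘ ∖-∷ g (c , d) (edges (d ∷ R.vs)) b)) R.stuck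
    }
    where
    g′ : BoolGraph _
    g′ = g ∖ [ (c , d) ]
    parity′ : EulerParity g′ d b
    parity′ v = begin
      parity (deg g′ v + 𝟙 (v == d) + 𝟙 (v == b))
        ≡⟨ parity-+2* (deg g′ v + 𝟙 (v == d) + 𝟙 (v == b)) (𝟙 (v == c)) ⟨
      parity (deg g′ v + 𝟙 (v == d) + 𝟙 (v == b) + 2 * 𝟙 (v == c))
        ≡⟨ cong parity (solve 4 (λ X C D B → X :+ D :+ B :+ con 2 :* C := X :+ C :+ D :+ C :+ B) refl (deg g′ v) _ _ _) ⟩
      parity (deg g′ v + 𝟙 (v == c) + 𝟙 (v == d) + 𝟙 (v == c) + 𝟙 (v == b))
        ≡⟨ cong (λ k → parity (k + 𝟙 (v == c) + 𝟙 (v == b))) (deg-∖-edge g cd v) ⟨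
      parity (deg g v + 𝟙 (v == c) + 𝟙 (v == b))
        ≡⟨ even v ⟩
      0ℙ ∎
      where open ≡-Reasoning
    smaller : degSum g′ < degSum g
    smaller = sum-mono-< (deg-∖-≤ g [ (c , d) ]) c
      (subst (deg g′ c <_) (sym (trans (deg-∖-edge g cd c) (cong (λ b → deg g′ c + 𝟙 b + 𝟙 (c == d)) (==-refl c))))
             (≤-trans (≤-reflexive (+-comm 1 (deg g′ c))) (m≤m+n _ _)))
    module R = StuckTrail (go k g′ d (≤-trans smaller (≤-pred small)) parity′)

record EulerTrail (g : BoolGraph n) (a b : Fin n) : Set where
  field
    vs     : List (Fin n)
    trail  : IsTrailIn g (a ∷ vs)
    ends≡  : ends a vs ≡ b
    visits : ∀ v → 2 * occ v (a ∷ vs) ≡ deg g v + 𝟙 (v == a) + 𝟙 (v == b)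

-- Hierholzer: keep a trail from a to b and splice closed trails of unused edges into it.
module Hierholzer (g : BoolGraph n) (a b : Fin n) (even : EulerParity g a b)
                  (connected : ∀ p → Path (adj g) a p) where

  record Tour : Set where
    field
      vs    : List (Fin n)
      trail : IsTrailIn g (a ∷ vs)
      ends≡ : ends a vs ≡ b

    unused : BoolGraph n
    unused = g ∖ edges (a ∷ vs)

    deg-unused : ∀ v → deg g v ≡ deg unused v + incidence v (edges (a ∷ vs))
    deg-unused = deg-∖ g (edges (a ∷ vs)) (proj₁ trail) (proj₂ trail)

    unused-even : ∀ v → Even (deg unused v)
    unused-even v = begin
      parity (deg unused v)                                              ≡⟨ parity-+2* (deg unused v) (occ v (a ∷ vs)) ⟨
      parity (deg unused v + 2 * occ v (a ∷ vs))                         ≡⟨ cong (λ k → parity (deg unused v + k))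
                                                                              (incidence+ends≡2*occ v a vs) ⟨
      parity (deg unused v + (I + 𝟙 (v == a) + 𝟙 (v == ends a vs)))     ≡⟨ cong parity (solve 4
                                                                              (λ U I A B → U :+ (I :+ A :+ B) := U :+ I :+ A :+ B)
                                                                              refl (deg unused v) I _ _) ⟩
      parity (deg unused v + I + 𝟙 (v == a) + 𝟙 (v == ends a vs))       ≡⟨ cong₂ (λ k e → parity (k + 𝟙 (v == a) + 𝟙 (v == e)))
                                                                              (deg-unused v) (sym ends≡) ⟨
      parity (deg g v + 𝟙 (v == a) + 𝟙 (v == b))                         ≡⟨ even v ⟩
      0ℙ ∎
      where
      open ≡-Reasoning
      I : ℕ
      I = incidence v (edges (a ∷ vs))

    -- Walking from a trail vertex towards an unused edge, the first vertex with an unused edge is on the trail.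
    touching : ∀ {u p} → Path (adj g) u p → 0 < deg unused p → u ∈ a ∷ vs →
               ∃ λ w → w ∈ a ∷ vs × 0 < deg unused w
    touching {u} ε                     p-touched u∈ = u , u∈ , p-touched
    touching {u} (_◅_ {j = v} uv v⇝p) p-touched u∈ with deg unused u in du
    ... | suc _ = u , u∈ , subst (0 <_) (sym du) (s≤s z≤n)
    ... | zero  = touching v⇝p p-touched (SameEdge-edges⇒∈ (a ∷ vs) (∖-removed g (edges (a ∷ vs)) uv unused-uv))
      where
      unused-uv : adj unused u v ≡ false
      unused-uv with adj unused u v in uv′
      ... | false = refl
      ... | true  = ⊥-elim (<-irrefl (sym du) (countTrue-pos (adj unused u) v uv′))

  open Tour

  extend : (T : Tour) (w : Fin n) → w ∈ a ∷ vs T → 0 < deg (unused T) w →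
           Σ Tour λ T′ → degSum (unused T′) < degSum (unused T)
  extend T w w∈ touched = T′ , shrinks
    where
    L M : List (Fin n)
    L  = proj₁ (∈-∃++ w∈)
    M  = proj₁ (proj₂ (∈-∃++ w∈))
    split : a ∷ vs T ≡ L ++ w ∷ M
    split = proj₂ (proj₂ (∈-∃++ w∈))
    module C = StuckTrail (stuckTrail (unused T) w w λ v →
                 trans (parity-+-twice (deg (unused T) v) (𝟙 (v == w))) (unused-even T v))
    vs′ : List (Fin n)
    vs′ = proj₁ (replace-suffix a (vs T) L w M (C.vs ++ M) split)
    split′ : a ∷ vs′ ≡ L ++ w ∷ C.vs ++ M
    split′ = proj₂ (replace-suffix a (vs T) L w M (C.vs ++ M) split)
    T′ : Tour
    T′ = record
      { vs    = vs′
      ; trail = subst (IsTrailIn g) (sym split′)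
                  (splice-trail g L w M C.vs (subst (IsTrailIn g) split (trail T))
                    (subst (λ K → IsTrailIn (g ∖ edges K) (w ∷ C.vs)) split C.trail) C.ends≡)
      ; ends≡ = begin
          ends a vs′                ≡⟨ ends-∷≡++∷ a vs′ L w (C.vs ++ M) split′ ⟩
          ends w (C.vs ++ M)        ≡⟨ ends-++ w C.vs M ⟩
          ends (ends w C.vs) M      ≡⟨ cong (λ e → ends e M) C.ends≡ ⟩
          ends w M                  ≡⟨ ends-∷≡++∷ a (vs T) L w M split ⟨
          ends a (vs T)             ≡⟨ ends≡ T ⟩
          b                         ∎
      }
      where open ≡-Reasoning
    E₁ E₂ E₃ : List (Fin n × Fin n)
    E₁ = edges (L ++ [ w ])
    E₂ = edges (w ∷ C.vs)
    E₃ = edges (w ∷ M)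
    edges-old : edges (a ∷ vs T) ≡ E₁ ++ E₃
    edges-old = trans (cong edges split) (edges-++-∷ L w M)
    edges-new : edges (a ∷ vs′) ≡ E₁ ++ E₂ ++ E₃
    edges-new = trans (cong edges split′) (trans (edges-++-∷ L w (C.vs ++ M))
                  (cong (λ K → E₁ ++ K) (trans (edges-∷-++ w C.vs M) (cong (λ e → E₂ ++ edges (e ∷ M)) C.ends≡))))
    new≡old∖C : ∀ v → deg (unused T′) v ≡ deg (unused T ∖ E₂) v
    new≡old∖C v = countTrue-cong λ q → begin
      adj (g ∖ edges (a ∷ vs′)) v q         ≡⟨ cong (λ K → adj (g ∖ K) v q) edges-new ⟩
      adj (g ∖ (E₁ ++ E₂ ++ E₃)) v q        ≡⟨ ∖-splice g E₁ E₂ E₃ v q ⟩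
      adj (g ∖ (E₁ ++ E₃) ∖ E₂) v q         ≡⟨ cong (λ K → adj (g ∖ K ∖ E₂) v q) edges-old ⟨
      adj (unused T ∖ E₂) v q               ∎
      where open ≡-Reasoning
    shrinks : degSum (unused T′) < degSum (unused T)
    shrinks = sum-mono-< (λ v → ≤-trans (≤-reflexive (new≡old∖C v)) (deg-∖-≤ (unused T) E₂ v)) w
                (subst (_< deg (unused T) w) (sym (trans (new≡old∖C w) C.stuck)) touched)

  complete : (T : Tour) → (∀ v → deg (unused T) v ≡ 0) → EulerTrail g a b
  complete T exhausted = record { vs = vs T ; trail = trail T ; ends≡ = ends≡ T ; visits = visits }
    where
    visits : ∀ v → 2 * occ v (a ∷ vs T) ≡ deg g v + 𝟙 (v == a) + 𝟙 (v == b)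
    visits v = begin
      2 * occ v (a ∷ vs T)                                            ≡⟨ incidence+ends≡2*occ v a (vs T) ⟨
      incidence v (edges (a ∷ vs T)) + 𝟙 (v == a) + 𝟙 (v == ends a (vs T))
        ≡⟨ cong₂ (λ k e → k + 𝟙 (v == a) + 𝟙 (v == e))
                 (trans (cong (_+ incidence v (edges (a ∷ vs T))) (sym (exhausted v))) (sym (deg-unused T v))) (ends≡ T) ⟩
      deg g v + 𝟙 (v == a) + 𝟙 (v == b)                               ∎
      where open ≡-Reasoning

  build : ∀ k (T : Tour) → degSum (unused T) < k → EulerTrail g a b
  build (suc k) T small with some (λ p → some (adj (unused T) p)) in has-edge
  ... | false = complete T λ v → countTrue-none (some-none (adj (unused T) v) (some-none _ has-edge v))
  ... | true with some-witness _ has-edge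
  ... | p , p-touched with some-witness (adj (unused T) p) p-touched
  ... | q , pq with touching T (connected p) (countTrue-pos (adj (unused T) p) q pq) (here refl)
  ... | w , w∈ , w-touched =
    let T′ , shrinks = extend T w w∈ w-touched in build k T′ (≤-trans shrinks (≤-pred small))

  eulerTrail : EulerTrail g a b
  eulerTrail = build (suc (degSum (unused start))) start ≤-refl
    where
    module S = StuckTrail (stuckTrail g a b even)
    start : Tour
    start = record { vs = S.vs ; trail = S.trail ; ends≡ = S.ends≡ }

-- Eliminating the pendant path

module Reduction (s : ℕ) (H : Graph n) (x : Fin n) where

  Conclusion : Set
  Conclusion =
    (Σ (Fin n) λ a → Σ (List (Fin n)) λ vs →
       IsClosedSTrail (square H) s a vs × Spanning (a ∷ vs) × trailDeg x (a ∷ vs) ≤ 2 * s ∸ 2)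
    ⊎
    (Σ (Fin n) λ x′ → Adj H x x′ × Σ (List (Fin n)) λ vs →
       IsSTrailBetween (square H) s x x′ vs × Spanning (x ∷ vs))

  Near : Fin n → Set
  Near d = d ≡ x ⊎ Adj H x d

  near-adj² : ∀ {u v} → u ≢ v → Near u → Near v → Adj (square H) u v
  near-adj² u≢v (inj₁ refl) (inj₁ refl) = ⊥-elim (u≢v refl)
  near-adj² u≢v (inj₁ refl) (inj₂ xv)   = u≢v , inj₁ xv
  near-adj² u≢v (inj₂ xu)   (inj₁ refl) = u≢v , inj₁ (Graph.sym H xu)
  near-adj² u≢v (inj₂ xu)   (inj₂ xv)   = u≢v , inj₂ (x , Graph.sym H xu , xv)

  Anchor : (Fin n → Bool) → Fin n → Set
  Anchor D t = D t ≡ true ⊎ t ≡ x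

  Anchored : BoolGraph n → (Fin n → Bool) → Fin n → Set
  Anchored e D u = ∃ λ t → Anchor D t × Path (adj e) u t

  -- The factor F seen from H: e is F on V(H), D the H-neighbours of y, and 𝟙 (v == x) is the edge zx.
  record State : Set where
    field
      e       : BoolGraph n
      e⊆H²    : ∀ {u v} → adj e u v ≡ true → Adj (square H) u v
      D       : Fin n → Bool
      D-near  : ∀ {d} → D d ≡ true → Near d
      even    : ∀ v → Even (deg e v + 𝟙 (D v) + 𝟙 (v == x))
      bounded : ∀ v → deg e v + 𝟙 (D v) + 𝟙 (v == x) ≤ 2 * s
      D-odd   : parity (countTrue D) ≡ 1ℙ
      anchored : ∀ v → Anchored e D v

  Smaller : State → Set
  Smaller S = Σ State λ S′ → countTrue (State.D S′) < countTrue (State.D S)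

  module _ (S : State) where
    open State S

    -- Replace the edges yu, yv of the pendant vertex y by a change of e at the pair u v.
    lift : ∀ {u v} → u ≢ v → D u ≡ true → D v ≡ true → (e′ : BoolGraph n) →
           (∀ {p q} → adj e′ p q ≡ true → Adj (square H) p q) →
           (∀ p → ∃ λ j → deg e′ p + 𝟙 (erase (erase D u) v p) + 2 * j ≡ deg e p + 𝟙 (D p)) →
           (∀ {p q} → adj e p q ≡ true → adj e′ p q ≡ true ⊎ SameEdge (p , q) (u , v)) →
           Anchored e′ (erase (erase D u) v) u → Anchored e′ (erase (erase D u) v) v → Smaller S
    lift {u} {v} u≢v Du Dv e′ e′⊆H² degrees rerouted u-anchored v-anchored = S′ , fewer
      where
      D′ : Fin n → Bool
      D′ = erase (erase D u) v
      Dv′ : erase D u v ≡ true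
      Dv′ = erase-keeps D Dv (λ v≡u → u≢v (sym v≡u))
      count : countTrue D ≡ 2 + countTrue D′
      count = trans (countTrue-erase D Du) (cong suc (countTrue-erase (erase D u) Dv′))
      reroute : ∀ {p t} → Path (adj e) p t → Anchor D t → Anchored e′ D′ p
      reroute {t = t} ε (inj₂ t≡x) = t , inj₂ t≡x , ε
      reroute {t = t} ε (inj₁ Dt) with t ≟ u | t ≟ v
      ... | yes refl | _        = u-anchored
      ... | no _     | yes refl = v-anchored
      ... | no t≢u   | no t≢v   = t , inj₁ (erase-keeps (erase D u) (erase-keeps D Dt t≢u) t≢v) , ε
      reroute (pq ◅ q⇝t) t-anchor with rerouted pq
      ... | inj₁ pq′ = let t′ , t′-anchor , q⇝t′ = reroute q⇝t t-anchor in t′ , t′-anchor , pq′ ◅ q⇝t′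
      ... | inj₂ (inj₁ (refl , refl)) = u-anchored
      ... | inj₂ (inj₂ (refl , refl)) = v-anchored
      S′ : State
      S′ = record
        { e = e′ ; e⊆H² = e′⊆H² ; D = D′
        ; D-near  = λ {d} D′d → D-near (erase-⊆ D u d (erase-⊆ (erase D u) v d D′d))
        ; even    = λ p → let j , eq = degrees p in begin
            parity (deg e′ p + 𝟙 (D′ p) + 𝟙 (p == x))           ≡⟨ parity-2*+ j _ ⟨
            parity (2 * j + (deg e′ p + 𝟙 (D′ p) + 𝟙 (p == x)))
              ≡⟨ cong parity (solve 4 (λ J X D′ P → J :+ (X :+ D′ :+ P) := X :+ D′ :+ J :+ P)
                                     refl (2 * j) (deg e′ p) (𝟙 (D′ p)) (𝟙 (p == x))) ⟩
            parity (deg e′ p + 𝟙 (D′ p) + 2 * j + 𝟙 (p == x))    ≡⟨ cong (λ k → parity (k + 𝟙 (p == x))) eq ⟩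
            parity (deg e p + 𝟙 (D p) + 𝟙 (p == x))             ≡⟨ even p ⟩
            0ℙ ∎
        ; bounded = λ p → let j , eq = degrees p in
            ≤-trans (+-monoˡ-≤ (𝟙 (p == x)) (subst (deg e′ p + 𝟙 (D′ p) ≤_) eq (m≤m+n _ (2 * j)))) (bounded p)
        ; D-odd   = trans (sym (parity-2*+ 1 (countTrue D′))) (trans (cong parity (sym count)) D-odd)
        ; anchored = λ p → let t , t-anchor , p⇝t = anchored p in reroute p⇝t t-anchor
        }
        where open ≡-Reasoning
      fewer : countTrue D′ < countTrue D
      fewer = subst (countTrue D′ <_) (sym count) (≤-trans (n<1+n _) (n≤1+n _))

    liftByAdding : ∀ {u v} (u≢v : u ≢ v) → D u ≡ true → D v ≡ true → adj e u v ≡ false →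
                   Anchored (addEdge e u v u≢v) (erase (erase D u) v) u → Smaller S
    liftByAdding {u} {v} u≢v Du Dv absent u-anchored =
      lift u≢v Du Dv e′ e′⊆H² degrees (inj₁ ∘ addEdge-⊇ e u≢v) u-anchored v-anchored
      where
      e′ : BoolGraph n
      e′ = addEdge e u v u≢v
      e′⊆H² : ∀ {p q} → adj e′ p q ≡ true → Adj (square H) p q
      e′⊆H² pq with addEdge-cases e u≢v pq
      ... | inj₁ pq′                = e⊆H² pq′
      ... | inj₂ (inj₁ (refl , refl)) = near-adj² u≢v (D-near Du) (D-near Dv)
      ... | inj₂ (inj₂ (refl , refl)) = Graph.sym (square H) (near-adj² u≢v (D-near Du) (D-near Dv))
      degrees : ∀ p → ∃ λ j → deg e′ p + 𝟙 (erase (erase D u) v p) + 2 * j ≡ deg e p + 𝟙 (D p)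
      degrees p = 0 , (begin
        deg e′ p + 𝟙 (erase (erase D u) v p) + 0
          ≡⟨ cong (λ k → k + 𝟙 (erase (erase D u) v p) + 0) (deg-addEdge e u≢v absent p) ⟩
        deg e p + 𝟙 (p == u) + 𝟙 (p == v) + 𝟙 (erase (erase D u) v p) + 0
          ≡⟨ solve 4 (λ X A B C → X :+ A :+ B :+ C :+ con 0 := X :+ (C :+ A :+ B)) refl (deg e p) _ _ _ ⟩
        deg e p + (𝟙 (erase (erase D u) v p) + 𝟙 (p == u) + 𝟙 (p == v))
          ≡⟨ cong (deg e p +_) (𝟙-erase₂ D u≢v Du Dv p) ⟨
        deg e p + 𝟙 (D p) ∎)
        where open ≡-Reasoning
      v-anchored : Anchored e′ (erase (erase D u) v) v
      v-anchored = let t , t-anchor , u⇝t = u-anchored in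
        t , t-anchor , trans (adj-sym e′ v u) (addEdge-new e u≢v) ◅ u⇝t

    liftByDeleting : ∀ {u v w} → u ≢ v → w ≢ u → w ≢ v → D u ≡ true → D v ≡ true → D w ≡ true →
                     adj e u v ≡ true → adj e u w ≡ true → adj e v w ≡ true → Smaller S
    liftByDeleting {u} {v} {w} u≢v w≢u w≢v Du Dv Dw uv uw vw =
      lift u≢v Du Dv e′ (e⊆H² ∘ ∖-⊆ e [ (u , v) ]) degrees rerouted
        (w , inj₁ D′w , ∖-keep e uw (λ { (inj₁ (_ , v≡w)) → w≢v (sym v≡w) ; (inj₂ (u≡w , _)) → w≢u (sym u≡w) })
           ◅ ε)
        (w , inj₁ D′w , ∖-keep e vw (λ { (inj₁ (u≡v , _)) → u≢v u≡v ; (inj₂ (u≡w , _)) → w≢u (sym u≡w) })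
           ◅ ε)
      where
      e′ : BoolGraph n
      e′ = e ∖ [ (u , v) ]
      D′w : erase (erase D u) v w ≡ true
      D′w = erase-keeps (erase D u) (erase-keeps D Dw w≢u) w≢v
      degrees : ∀ p → ∃ λ j → deg e′ p + 𝟙 (erase (erase D u) v p) + 2 * j ≡ deg e p + 𝟙 (D p)
      degrees p = 𝟙 (p == u) + 𝟙 (p == v) , (begin
        deg e′ p + 𝟙 (erase (erase D u) v p) + 2 * (𝟙 (p == u) + 𝟙 (p == v))
          ≡⟨ solve 4 (λ X C A B → X :+ C :+ con 2 :* (A :+ B) := X :+ A :+ B :+ (C :+ A :+ B)) refl (deg e′ p) _ _ _ ⟩
        deg e′ p + 𝟙 (p == u) + 𝟙 (p == v) + (𝟙 (erase (erase D u) v p) + 𝟙 (p == u) + 𝟙 (p == v))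
          ≡⟨ cong₂ _+_ (deg-∖-edge e uv p) (𝟙-erase₂ D u≢v Du Dv p) ⟨
        deg e p + 𝟙 (D p) ∎)
        where open ≡-Reasoning
      rerouted : ∀ {p q} → adj e p q ≡ true → adj e′ p q ≡ true ⊎ SameEdge (p , q) (u , v)
      rerouted {p} {q} pq with adj e′ p q in kept
      ... | true  = inj₁ refl
      ... | false with ∖-removed e [ (u , v) ] pq kept
      ...   | here same = inj₂ same

    component-parity : (C : Fin n → Bool) → Closed (adj e) C →
                       parity (countTrue (λ p → C p ∧ D p) + 𝟙 (C x)) ≡ 0ℙ
    component-parity C closed = begin
      parity (countTrue (λ p → C p ∧ D p) + 𝟙 (C x))
        ≡⟨ cong₂ (λ k l → parity (k + l)) (countTrue≡sum (λ p → C p ∧ D p)) (sym (countTrue-at C x)) ⟩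
      parity (sum (λ p → 𝟙 (C p ∧ D p)) + countTrue (λ p → C p ∧ p == x))
        ≡⟨ cong (λ k → parity (sum (λ p → 𝟙 (C p ∧ D p)) + k)) (countTrue≡sum (λ p → C p ∧ p == x)) ⟩
      parity (sum (λ p → 𝟙 (C p ∧ D p)) + sum (λ p → 𝟙 (C p ∧ p == x)))
        ≡⟨ cong parity (∑-distrib-+ (λ p → 𝟙 (C p ∧ D p)) _) ⟨
      parity (sum (λ p → 𝟙 (C p ∧ D p) + 𝟙 (C p ∧ p == x)))
        ≡⟨ cong parity (sum-cong-≗ restricted) ⟩
      parity (sum (λ p → if C p then 𝟙 (D p) + 𝟙 (p == x) else 0))
        ≡⟨ closed-weight-even e C closed (λ p → 𝟙 (D p) + 𝟙 (p == x))
             (λ p → trans (cong parity (sym (+-assoc (deg e p) _ _))) (even p)) ⟩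
      0ℙ ∎
      where
      open ≡-Reasoning
      restricted : ∀ p → 𝟙 (C p ∧ D p) + 𝟙 (C p ∧ p == x) ≡ (if C p then 𝟙 (D p) + 𝟙 (p == x) else 0)
      restricted p with C p
      ... | true  = refl
      ... | false = refl

  module Finish (S : State) (d : Fin n) (D≡d : ∀ t → State.D S t ≡ t == d) where
    open State S

    -- The component of d contains exactly one vertex of D, so by parity it must contain x.
    reaches-x : ∀ v → Path (adj e) v x
    reaches-x v with anchored v
    ... | t , inj₂ refl , v⇝x = v⇝x
    ... | t , inj₁ Dt   , v⇝t = v⇝t ◅◅ subst (λ t → Path (adj e) t x) (sym (==⇒≡ (trans (sym (D≡d t)) Dt))) d⇝x
      where
      open Reachability (adj e)
      d⇝x : Path (adj e) d x
      d⇝x with component d x in dx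
      ... | true  = component-reachable d x dx
      ... | false = ⊥-elim (1ℙ≢0ℙ (trans (cong parity (cong₂ _+_ (sym only-d) (cong 𝟙 (sym dx))))
                                         (component-parity S (component d) (component-closed d))))
        where
        1ℙ≢0ℙ : 1ℙ ≢ 0ℙ
        1ℙ≢0ℙ ()
        only-d : countTrue (λ p → component d p ∧ D p) ≡ 1
        only-d = trans (countTrue-cong (λ p → cong (component d p ∧_) (D≡d p)))
                       (trans (countTrue-at (component d) d) (cong 𝟙 (component-self d)))

    euler-parity : EulerParity e x d
    euler-parity v = trans (cong parity (solve 3 (λ X A B → X :+ A :+ B := X :+ B :+ A) refl (deg e v) _ _))
                           (trans (cong (λ b → parity (deg e v + 𝟙 b + 𝟙 (v == x))) (sym (D≡d v))) (even v))

    module T = EulerTrail (Hierholzer.eulerTrail e x d euler-parity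
                             (λ p → Star.reverse (λ {u} {v} uv → trans (adj-sym e v u) uv) (reaches-x p)))

    visits-bounded : ∀ v → 2 * occ v (x ∷ T.vs) ≤ 2 * s
    visits-bounded v = begin
      2 * occ v (x ∷ T.vs)                ≡⟨ T.visits v ⟩
      deg e v + 𝟙 (v == x) + 𝟙 (v == d)   ≡⟨ solve 3 (λ X A B → X :+ A :+ B := X :+ B :+ A) refl (deg e v) _ _ ⟩
      deg e v + 𝟙 (v == d) + 𝟙 (v == x)   ≡⟨ cong (λ b → deg e v + 𝟙 b + 𝟙 (v == x)) (D≡d v) ⟨
      deg e v + 𝟙 (D v) + 𝟙 (v == x)     ≤⟨ bounded v ⟩
      2 * s                               ∎
      where open ≤-Reasoning

    visits-≤ : ∀ v → occ v (x ∷ T.vs) ≤ s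
    visits-≤ v = *-cancelˡ-≤ 2 (visits-bounded v)

    is-trail : IsTrail (square H) (x ∷ T.vs)
    is-trail = trail⇒IsTrail e (square H) e⊆H² (x ∷ T.vs) T.trail

    spanning : Spanning (x ∷ T.vs)
    spanning v with v ≟ x | reaches-x v
    ... | yes refl | _ = here refl
    ... | no v≢x | ε = ⊥-elim (v≢x refl)
    ... | no _   | _◅_ {j = q} vq _ = occ-pos⇒∈ v (x ∷ T.vs) (*-cancelˡ-< 2 0 _ (begin-strict
      2 * 0                               <⟨ countTrue-pos (adj e v) q vq ⟩
      deg e v                             ≤⟨ m≤m+n _ _ ⟩
      deg e v + (𝟙 (v == x) + 𝟙 (v == d)) ≡⟨ +-assoc (deg e v) _ _ ⟨
      deg e v + 𝟙 (v == x) + 𝟙 (v == d)   ≡⟨ T.visits v ⟨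
      2 * occ v (x ∷ T.vs)                ∎))
      where open ≤-Reasoning

    closed-trail : d ≡ x → Conclusion
    closed-trail refl = inj₁ (x , T.vs , (is-trail , T.ends≡ , occ-≤) , spanning , degree-≤)
      where
      occ-≤ : ∀ v → occ v T.vs ≤ s
      occ-≤ v = ≤-trans (m≤n+m (occ v T.vs) (𝟙 (v == x))) (visits-≤ v)
      degree-≤ : trailDeg x (x ∷ T.vs) ≤ 2 * s ∸ 2
      degree-≤ = ≤-trans (≤-reflexive (sym (m+n∸n≡m _ 2))) (∸-monoˡ-≤ 2 (begin
        trailDeg x (x ∷ T.vs) + 2
          ≡⟨ cong (_+ 2) (trailDeg≡incidence x (x ∷ T.vs) (All.map (adj⇒≢ e) (proj₁ T.trail))) ⟩
        incidence x (edges (x ∷ T.vs)) + 2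
          ≡⟨ +-assoc (incidence x (edges (x ∷ T.vs))) 1 1 ⟨
        incidence x (edges (x ∷ T.vs)) + 1 + 1
          ≡⟨ cong₂ (λ b c → incidence x (edges (x ∷ T.vs)) + 𝟙 b + 𝟙 c)
                   (==-refl x) (trans (cong (x ==_) T.ends≡) (==-refl x)) ⟨
        incidence x (edges (x ∷ T.vs)) + 𝟙 (x == x) + 𝟙 (x == ends x T.vs)
          ≡⟨ incidence+ends≡2*occ x x T.vs ⟩
        2 * occ x (x ∷ T.vs)
          ≤⟨ visits-bounded x ⟩
        2 * s ∎))
        where open ≤-Reasoning

    open-trail : d ≢ x → Conclusion
    open-trail d≢x = inj₂ (d , xd , T.vs , (is-trail , T.ends≡ , visits-≤) , spanning)
      where
      xd : Adj H x d
      xd with D-near (trans (D≡d d) (==-refl d))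
      ... | inj₁ d≡x = ⊥-elim (d≢x d≡x)
      ... | inj₂ xd  = xd

    conclusion : Conclusion
    conclusion with d ≟ x
    ... | yes d≡x = closed-trail d≡x
    ... | no d≢x  = open-trail d≢x

  module _ (S : State) where
    open State S
    open Reachability (adj e)

    -- A D-vertex u cut off from x: its component has an even number of anchors, so it contains
    -- another D-vertex t, while the odd rest of D outside it provides the partner v.
    liftDetached : ∀ {u} → D u ≡ true → component u x ≡ false → Smaller S
    liftDetached {u} Du ux = liftByAdding S u≢v Du Dv absent
      (t , inj₁ (erase-keeps (erase D u) (erase-keeps D Dt t≢u) t≢v) , Star.map (addEdge-⊇ e u≢v) (component-reachable u t Ct))
      where
      C CD : Fin n → Bool
      C = component u
      CD p = C p ∧ D p
      CD-even : parity (countTrue CD) ≡ 0ℙ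
      CD-even = trans (cong parity (sym (+-identityʳ (countTrue CD))))
                      (subst (λ b → parity (countTrue CD + 𝟙 b) ≡ 0ℙ) ux (component-parity S C (component-closed u)))
      others-odd : parity (countTrue (erase CD u)) ≡ 1ℙ
      others-odd = parity-suc-even (countTrue (erase CD u))
                     (trans (cong parity (sym (countTrue-erase CD (cong₂ _∧_ (component-self u) Du)))) CD-even)
      t-witness = countTrue-witness (erase CD u) (odd⇒pos others-odd)
      t : Fin n
      t    = proj₁ t-witness
      t-in = proj₂ t-witness
      Ct = proj₁ (∧-true-elim (erase-⊆ CD u t t-in))
      Dt = proj₂ (∧-true-elim (erase-⊆ CD u t t-in))
      t≢u = erase-≢ CD t-in
      D∖C : Fin n → Bool
      D∖C p = D p ∧ not (C p)
      outside-odd : parity (countTrue D∖C) ≡ 1ℙ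
      outside-odd = trans (sym (parity-even+ (countTrue (λ p → D p ∧ C p)) _
                                 (trans (cong parity (countTrue-cong (λ p → Boolₚ.∧-comm (D p) (C p)))) CD-even)))
                          (trans (cong parity (sym (countTrue-split D C))) D-odd)
      v-witness = countTrue-witness D∖C (odd⇒pos outside-odd)
      v : Fin n
      v  = proj₁ v-witness
      Dv = proj₁ (∧-not-true-elim (proj₂ v-witness))
      Cv = proj₂ (∧-not-true-elim {D v} (proj₂ v-witness))
      outside : ∀ {p} → C p ≡ true → p ≢ v
      outside Cp refl = true≢false (trans (sym Cp) Cv)
      u≢v = outside (component-self u)
      t≢v = outside Ct
      absent : adj e u v ≡ false
      absent with adj e u v in uv
      ... | false = refl
      ... | true  = ⊥-elim (true≢false (trans (sym (component-closed u u v (component-self u) uv)) Cv))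

    via-x : ∀ {p q} (p≢q : p ≢ q) → Path (adj e) p x → Anchored (addEdge e p q p≢q) (erase (erase D p) q) p
    via-x p≢q p⇝x = x , inj₂ refl , Star.map (addEdge-⊇ e p≢q) p⇝x

    -- All of D is joined to x: pair two non-adjacent D-vertices, or delete an edge of a D-triangle.
    liftAttached : (∀ {u} → D u ≡ true → Path (adj e) u x) → 3 ≤ countTrue D → Smaller S
    liftAttached attached three with countTrue-three D three
    ... | u , v , w , Du , Dv , Dw , u≢v , w≢u , w≢v with adj e u v in uv | adj e u w in uw | adj e v w in vw
    ... | false | _     | _     = liftByAdding S u≢v Du Dv uv (via-x u≢v (attached Du))
    ... | true  | false | _     = liftByAdding S (w≢u ∘ sym) Du Dw uw (via-x (w≢u ∘ sym) (attached Du))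
    ... | true  | true  | false = liftByAdding S (w≢v ∘ sym) Dv Dw vw (via-x (w≢v ∘ sym) (attached Dv))
    ... | true  | true  | true  = liftByDeleting S u≢v w≢u w≢v Du Dv Dw uv uw vw

    attached : some (λ u → D u ∧ not (component u x)) ≡ false → ∀ {u} → D u ≡ true → Path (adj e) u x
    attached none {u} Du with component u x in ux | some-none _ none u
    ... | true  | _ = component-reachable u x ux
    ... | false | not-detached rewrite Du with not-detached
    ... | ()

    step : Conclusion ⊎ Smaller S
    step = by-size (countTrue D) refl
      where
      by-size : ∀ c → countTrue D ≡ c → Conclusion ⊎ Smaller S
      by-size 0 count with () ← trans (cong parity (sym count)) D-odd
      by-size 1 count = let d , D≡d = countTrue≡1 D count in inj₁ (Finish.conclusion S d D≡d)
      by-size 2 count with () ← trans (cong parity (sym count)) D-odd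
      by-size (suc (suc (suc c))) count with some (λ u → D u ∧ not (component u x)) in detached
      ... | true  = let _ , Du∧ux = some-witness (λ u → D u ∧ not (component u x)) detached
                    in inj₂ (uncurry liftDetached (∧-not-true-elim Du∧ux))
      ... | false = inj₂ (liftAttached (attached detached) (subst (3 ≤_) (sym count) (s≤s (s≤s (s≤s z≤n)))))

  reduce : ∀ k (S : State) → countTrue (State.D S) < k → Conclusion
  reduce (suc k) S small with step S
  ... | inj₁ done         = done
  ... | inj₂ (S′ , fewer) = reduce k S′ (≤-trans fewer (≤-pred small))

module FromFactor (s : ℕ) (H : Graph n) (x : Fin n) (F : SpanningSubgraph (square (HxP H x)))
                  (F-connected : Connected (asGraph F))
                  (F-degrees : ∀ v → (∃ λ k → degSub F v ≡ 2 * k) × degSub F v ≤ 2 * s) where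

  open Reduction s H x

  G : Graph (suc (suc n))
  G = square (HxP H x)

  y z : Fin (suc (suc n))
  y = zero
  z = suc zero

  ⟨_⟩ : Fin n → Fin (suc (suc n))
  ⟨ v ⟩ = suc (suc v)

  F-sym : ∀ u v → E F u v ≡ E F v u
  F-sym = SpanningSubgraph.E-sym F

  F⊆G : ∀ {u v} → E F u v ≡ true → Adj G u v
  F⊆G = SpanningSubgraph.E-sub F _ _

  F-irrefl : ∀ v → E F v v ≡ false
  F-irrefl v with E F v v in vv
  ... | false = refl
  ... | true  = ⊥-elim (Graph.irrefl G (F⊆G vv))

  F-even : ∀ v → Even (countTrue (E F v))
  F-even v = let k , deg≡ = proj₁ (F-degrees v) in trans (cong parity deg≡) (parity-2* k)

  G-z : ∀ {v} → Adj G z ⟨ v ⟩ → v ≡ x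
  G-z (_ , inj₂ (zero , _ , z-x)) = z-x

  G-y : ∀ {d} → Adj G y ⟨ d ⟩ → Near d
  G-y (_ , inj₁ y-d)                  = inj₁ y-d
  G-y (_ , inj₂ (suc (suc w) , refl , xd)) = inj₂ xd

  G-H : ∀ {u v} → Adj G ⟨ u ⟩ ⟨ v ⟩ → Adj (square H) u v
  G-H (u≢v , inj₁ uv)                  = u≢v ∘ cong ⟨_⟩ , inj₁ uv
  G-H (u≢v , inj₂ (zero , refl , refl)) = ⊥-elim (u≢v refl)
  G-H (u≢v , inj₂ (suc (suc w) , uw , wv)) = u≢v ∘ cong ⟨_⟩ , inj₂ (w , uw , wv)

  -- z has degree at least one (F is connected), is even, and its only possible neighbours are y and x.
  z-edges : E F z y ≡ true × E F z ⟨ x ⟩ ≡ true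
  z-edges = by-cases (E F z y) (countTrue (λ i → E F z ⟨ i ⟩)) refl refl
    where
    H-row≤1 : countTrue (λ i → E F z ⟨ i ⟩) ≤ 1
    H-row≤1 = ≤-trans (countTrue-mono (λ i zi → subst (λ t → i == t ≡ true) (G-z (F⊆G zi)) (==-refl i)))
                      (≤-reflexive (countTrue-single x))
    degree≡ : countTrue (E F z) ≡ 𝟙 (E F z y) + countTrue (λ i → E F z ⟨ i ⟩)
    degree≡ = cong (λ b → 𝟙 (E F z y) + (𝟙 b + countTrue (λ i → E F z ⟨ i ⟩))) (F-irrefl z)
    positive : 0 < countTrue (E F z)
    positive with F-connected z y
    ... | w ∷ _ , zw ∷ _ , _ = countTrue-pos (E F z) w zw
    by-cases : ∀ b c → E F z y ≡ b → countTrue (λ i → E F z ⟨ i ⟩) ≡ c → E F z y ≡ true × E F z ⟨ x ⟩ ≡ true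
    by-cases _     (suc (suc _)) _  row = ⊥-elim (<-irrefl refl (≤-trans (s≤s (s≤s z≤n)) (subst (_≤ 1) row H-row≤1)))
    by-cases false zero          zy row with () ← subst (0 <_) (trans degree≡ (cong₂ (λ b c → 𝟙 b + c) zy row)) positive
    by-cases false (suc zero)    zy row with () ← subst Even (trans degree≡ (cong₂ (λ b c → 𝟙 b + c) zy row)) (F-even z)
    by-cases true  zero          zy row with () ← subst Even (trans degree≡ (cong₂ (λ b c → 𝟙 b + c) zy row)) (F-even z)
    by-cases true  (suc zero)    zy row with countTrue-witness (λ i → E F z ⟨ i ⟩) (≤-reflexive (sym row))
    ... | i , zi = zy , subst (λ t → E F z ⟨ t ⟩ ≡ true) (G-z (F⊆G zi)) zi

  F-vz : ∀ v → E F ⟨ v ⟩ z ≡ v == x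
  F-vz v with v ≟ x
  ... | yes refl = trans (F-sym ⟨ v ⟩ z) (proj₂ z-edges)
  ... | no v≢x with E F ⟨ v ⟩ z in vz
  ... | false = refl
  ... | true  = ⊥-elim (v≢x (G-z (F⊆G (trans (F-sym z ⟨ v ⟩) vz))))

  e : BoolGraph n
  e = record
    { adj        = λ u v → E F ⟨ u ⟩ ⟨ v ⟩
    ; adj-sym    = λ u v → F-sym ⟨ u ⟩ ⟨ v ⟩
    ; adj-irrefl = λ v → F-irrefl ⟨ v ⟩
    }

  D : Fin n → Bool
  D d = E F y ⟨ d ⟩

  degree-H : ∀ v → countTrue (E F ⟨ v ⟩) ≡ deg e v + 𝟙 (D v) + 𝟙 (v == x)
  degree-H v = trans (cong₂ (λ a b → 𝟙 a + (𝟙 b + deg e v)) (F-sym ⟨ v ⟩ y) (F-vz v))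
                     (solve 3 (λ A B C → A :+ (B :+ C) := C :+ A :+ B) refl (𝟙 (D v)) (𝟙 (v == x)) (deg e v))

  degree-y : countTrue (E F y) ≡ 1 + countTrue D
  degree-y = cong₂ (λ a b → 𝟙 a + (𝟙 b + countTrue D)) (F-irrefl y) (trans (F-sym y z) (proj₁ z-edges))

  walk⇒path : ∀ u vs → Linked (λ a b → E F a b ≡ true) (u ∷ vs) → Path (E F) u (ends u vs)
  walk⇒path u []       _          = ε
  walk⇒path u (w ∷ vs) (uw ∷ walk) = uw ◅ walk⇒path w vs walk

  -- Follow a walk of F from an H-vertex to x until it first leaves H, through y or through z.
  project : ∀ v {q} → Path (E F) ⟨ v ⟩ q → q ≡ ⟨ x ⟩ → Anchored e D v
  project v ε                          refl = v , inj₂ refl , ε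
  project v (_◅_ {j = zero} vy _)           _ = v , inj₁ (trans (F-sym y ⟨ v ⟩) vy) , ε
  project v (_◅_ {j = suc zero} vz _)       _ = v , inj₂ (==⇒≡ (trans (sym (F-vz v)) vz)) , ε
  project v (_◅_ {j = suc (suc w)} vw w⇝q) q≡x =
    let t , t-anchor , w⇝t = project w w⇝q q≡x in t , t-anchor , vw ◅ w⇝t

  initial : State
  initial = record
    { e        = e
    ; e⊆H²     = G-H ∘ F⊆G
    ; D        = D
    ; D-near   = G-y ∘ F⊆G
    ; even     = λ v → trans (cong parity (sym (degree-H v))) (F-even ⟨ v ⟩)
    ; bounded  = λ v → subst (_≤ 2 * s) (degree-H v) (proj₂ (F-degrees ⟨ v ⟩))
    ; D-odd    = odd-D
    ; anchored = λ v → let vs , walk , reaches = F-connected ⟨ v ⟩ ⟨ x ⟩ in project v (walk⇒path ⟨ v ⟩ vs walk) reaches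
    }
    where
    odd-D : parity (countTrue D) ≡ 1ℙ
    odd-D = parity-suc-even (countTrue D) (trans (cong parity (sym degree-y)) (F-even y))

lemma4 : ∀ {n : ℕ} (s : ℕ) → 1 ≤ s → (H : Graph n) → (x : Fin n) →
    Connected H →
    Has22sFactor (square (HxP H x)) s →
    (Σ (Fin n) λ a → Σ (List (Fin n)) λ vs →
        IsClosedSTrail (square H) s a vs × Spanning (a ∷ vs) ×
        trailDeg x (a ∷ vs) ≤ 2 * s ∸ 2)
    ⊎
    (Σ (Fin n) λ x′ → Adj H x x′ × Σ (List (Fin n)) λ vs →
        IsSTrailBetween (square H) s x x′ vs × Spanning (x ∷ vs))
-- Connectivity of H and s ≥ 1 are implied by the factor and not needed.
lemma4 s _ H x _ (F , F-connected , F-degrees) =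
  Reduction.reduce s H x (suc (countTrue D)) initial ≤-refl
  where open FromFactor s H x F F-connected F-degrees
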